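{- For every set $\mathcal{D}\subseteq\mathbb{Z}_{\geq 0}$ and integers $n,m$, one has $\operatorname{Marked}_{\operatorname{MG}^{(\mathcal{D},*)}_{n,m}}(-1,-1)=|\operatorname{SG}^{(\mathcal{D})}_{n,m}|$.
   Context: A multigraph on $\{1,\dots,n\}$ has a multiset $E(G)$ of edges (unordered pairs $\{v,w\}$, loops $v=w$ allowed); the degree of a vertex is its number of occurrences in $E(G)$ (loops count $2$). $\operatorname{MG}^{(\mathcal{D})}_{n,m}$: multigraphs on $\{1,\dots,n\}$ with $m$ edges (with multiplicity) and all degrees in $\mathcal{D}$; $\operatorname{SG}^{(\mathcal{D})}_{n,m}$: those that are simple (no loops, no edge of multiplicity $\geq 2$). Writing $|E|_e$ for the multiplicity of $e$ in $E$, $\operatorname{MG}^{(\mathcal{D},*)}_{n,m}$ is the set of $G\in\operatorname{MG}^{(\mathcal{D})}_{n,m}$ such that for all vertices $u,v,w$: $|E(G)|_{\{v,v\}}\leq 1$; $|E(G)|_{\{v,w\}}\leq 2$; $|E(G)|_{\{u,v\}}=|E(G)|_{\{v,w\}}=2\Rightarrow u=w$; and $\{v,v\}\in E(G)\Rightarrow |E(G)|_{\{v,w\}}\leq 1$ for all $w$. A marked multigraph is a triple $(V,E,\bar E)$ with $V=\{1,\dots,n\}$ and $E,\bar E$ multisets of unordered pairs of vertices (normal and marked edges); it belongs to a family $\mathcal{F}$ of multigraphs if $(V,E\cup\bar E)\in\mathcal{F}$. With $m=|E|+|\bar E|$, an ordering is a sequence $((v_1,w_1,t_1),\dots,(v_m,w_m,t_m))\in(V\times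 V\times\{0,1\})^m$ with $\{\{v_i,w_i\}: t_i=0\}=E$ and $\{\{v_i,w_i\}:t_i=1\}=\bar E$ as multisets; $\kappa(G)={\sf orderings}(G)/(2^m m!)$. For a family $\mathcal{F}$ of multigraphs, $\operatorname{Marked}(\mathcal{F})$ is the set of marked multigraphs belonging to $\mathcal{F}$ such that each vertex is in exactly one of the cases: it belongs to no marked edge; it belongs to one marked loop and no other marked edge; it belongs to two identical marked (non-loop) edges and no other marked edge. Its generating function is $\operatorname{Marked}_{\mathcal{F}}(u,v)=\sum_{G\in\operatorname{Marked}(\mathcal{F})}\kappa(G)u^{k(G)}v^{\ell(G)}$, where $\ell(G)$ is the number of loops in $\bar E(G)$ and $k(G)$ the number of distinct non-loop edges in $\bar E(G)$. -}

module Defs where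

open import Data.Bool using (Bool; true; false; _∧_; _∨_; not; if_then_else_)
open import Data.Nat as ℕ using (ℕ; zero; suc; _+_; _*_; _∸_; _^_; _!; _≡ᵇ_; _≤ᵇ_)
open import Data.Nat.Properties using (m*n≢0; m^n≢0; _!≢0)
open import Data.Fin as Fin using (Fin; toℕ)
open import Data.Fin.Properties as FinP using ()
open import Data.List as List using (List; []; _∷_; [_]; map; concatMap; filter; upTo; allFin; length; foldr)
open import Data.Bool.ListAction using (all; any)
open import Data.Vec as Vec using (Vec; []; _∷_)
open import Data.Vec.Properties as VecP using ()
open import Data.Product using (_×_; _,_; proj₁; proj₂)
open import Data.Product.Properties using (≡-dec)
open import Data.Integer as ℤ using (ℤ; +_)
open import Data.Rational as ℚ using (ℚ)
open import Relation.Nullary.Decidable as Dec using (⌊_⌋)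
open import Relation.Binary.PropositionalEquality using (cong)
open import Function using (_$_)
open import Relation.Binary.Definitions using (DecidableEquality)
open import Data.Bool as Bool using (T?)

-- Vertices.  The vertex set {1,…,n} is represented by Fin n
-- (vertex i+1 ↔ i : Fin n).

_=ᶠ_ : ∀ {n} → Fin n → Fin n → Bool
i =ᶠ j = ⌊ i Fin.≟ j ⌋

-- Unordered pairs {v,w} (loops v = w allowed), each listed once via its
-- representative (i , j) with i ≤ j.

pairsL : (n : ℕ) → List (Fin n × Fin n)
pairsL n = concatMap (λ i → map (λ j → i , j)
                               (filter (λ j → toℕ i ℕ.≤? toℕ j) (allFin n)))
                     (allFin n)

P : ℕ → ℕ
P n = length (pairsL n)

pairs : (n : ℕ) → Vec (Fin n × Fin n) (P n)
pairs n = Vec.fromList (pairsL n)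

represents : ∀ {n} → Fin n × Fin n → Fin n → Fin n → Bool
represents (i , j) v w = (i =ᶠ v ∧ j =ᶠ w) ∨ (i =ᶠ w ∧ j =ᶠ v)

isLoop : ∀ {n} → Fin n × Fin n → Bool
isLoop (i , j) = i =ᶠ j

occ : ∀ {n} → Fin n → Fin n × Fin n → ℕ
occ v (i , j) = (if i =ᶠ v then 1 else 0) + (if j =ᶠ v then 1 else 0)

-- A multiset of unordered pairs of vertices: its multiplicity function,
-- one entry per unordered pair (aligned with `pairs n`).

record EdgeMS (n : ℕ) : Set where
  constructor ms
  field mults : Vec ℕ (P n)
open EdgeMS public

mult : ∀ {n} → EdgeMS n → Fin n → Fin n → ℕ
mult {n} (ms E) v w =
  Vec.sum (Vec.zipWith (λ p k → if represents p v w then k else 0) (pairs n) E)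

size : ∀ {n} → EdgeMS n → ℕ
size (ms E) = Vec.sum E

deg : ∀ {n} → EdgeMS n → Fin n → ℕ
deg {n} (ms E) v = Vec.sum (Vec.zipWith (λ p k → k * occ v p) (pairs n) E)

_∪ᴱ_ : ∀ {n} → EdgeMS n → EdgeMS n → EdgeMS n
ms E ∪ᴱ ms F = ms (Vec.zipWith _+_ E F)

-- Families of multigraphs on {1..n}: decidable predicates on edge
-- multisets.  A subset 𝒟 ⊆ ℤ≥0 is given by its characteristic function.

Family : ℕ → Set
Family n = EdgeMS n → Bool

allV : (n : ℕ) → (Fin n → Bool) → Bool
allV n f = all f (allFin n)

anyV : (n : ℕ) → (Fin n → Bool) → Bool
anyV n f = any f (allFin n)

MG : (𝒟 : ℕ → Bool) (n m : ℕ) → Family n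
MG 𝒟 n m E = (size E ≡ᵇ m) ∧ allV n (λ v → 𝒟 (deg E v))

SG : (𝒟 : ℕ → Bool) (n m : ℕ) → Family n
SG 𝒟 n m E = MG 𝒟 n m E ∧
  allV n (λ v → (mult E v v ≡ᵇ 0) ∧ allV n (λ w → mult E v w ≤ᵇ 1))

MG* : (𝒟 : ℕ → Bool) (n m : ℕ) → Family n
MG* 𝒟 n m E = MG 𝒟 n m E ∧
  allV n (λ v →
    (mult E v v ≤ᵇ 1) ∧
    allV n (λ w →
      (mult E v w ≤ᵇ 2) ∧
      ((mult E v v ≡ᵇ 0) ∨ (mult E v w ≤ᵇ 1)) ∧
      allV n (λ u → not ((mult E u v ≡ᵇ 2) ∧ (mult E v w ≡ᵇ 2)) ∨ (u =ᶠ w))))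

-- Marked multigraphs (V , E , Ē) on V = {1..n}.

Marked : ℕ → Set
Marked n = EdgeMS n × EdgeMS n

belongs : ∀ {n} → Family n → Marked n → Bool
belongs 𝓕 (E , Ē) = 𝓕 (E ∪ᴱ Ē)

-- each vertex: no marked edge; or exactly one marked loop and no other
-- marked edge; or two identical marked non-loop edges and no other
markedCondition : ∀ {n} → Marked n → Bool
markedCondition {n} (E , Ē) = allV n (λ v →
    (deg Ē v ≡ᵇ 0)
  ∨ ((mult Ē v v ≡ᵇ 1) ∧ (deg Ē v ≡ᵇ 2))
  ∨ anyV n (λ w → not (v =ᶠ w) ∧ (mult Ē v w ≡ᵇ 2) ∧ (deg Ē v ≡ᵇ 2)))

isInMarked : ∀ {n} → Family n → Marked n → Bool
isInMarked 𝓕 G = belongs 𝓕 G ∧ markedCondition G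

ℓ : ∀ {n} → Marked n → ℕ
ℓ {n} (E , ms Ē) =
  Vec.sum (Vec.zipWith (λ p k → if isLoop p then k else 0) (pairs n) Ē)

kk : ∀ {n} → Marked n → ℕ
kk {n} (E , ms Ē) =
  Vec.sum (Vec.zipWith (λ p k → if isLoop p ∨ (k ≡ᵇ 0) then 0 else 1) (pairs n) Ē)

comps : (k m : ℕ) → List (Vec ℕ k)
comps zero zero = [ [] ]
comps zero (suc _) = []
comps (suc k) m = concatMap (λ a → map (a ∷_) (comps k (m ∸ a))) (upTo (suc m))

multisets : (n m : ℕ) → List (EdgeMS n)
multisets n m = map ms (comps (P n) m)

markedAll : (n m : ℕ) → List (Marked n)
markedAll n m =
  concatMap (λ j → List.cartesianProduct (multisets n (m ∸ j)) (multisets n j))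
            (upTo (suc m))

seqs : ∀ {A : Set} → List A → (m : ℕ) → List (Vec A m)
seqs xs zero = [ [] ]
seqs xs (suc m) = concatMap (λ x → map (x ∷_) (seqs xs m)) xs

Triple : ℕ → Set
Triple n = Fin n × Fin n × Bool

triples : (n : ℕ) → List (Triple n)
triples n = List.cartesianProduct (allFin n)
              (List.cartesianProduct (allFin n) (true ∷ false ∷ []))

edgesWith : ∀ {n m} → Bool → Vec (Triple n) m → EdgeMS n
edgesWith {n} t s =
  ms $ Vec.map (λ p → Vec.sum (Vec.map (λ x →
              if represents p (proj₁ x) (proj₁ (proj₂ x)) ∧ ⌊ proj₂ (proj₂ x) Bool.≟ t ⌋
              then 1 else 0) s))
          (pairs n)

markedOf : ∀ {n m} → Vec (Triple n) m → Marked n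
markedOf s = edgesWith false s , edgesWith true s

_≟ᴹ_ : ∀ {n} → DecidableEquality (Marked n)
_≟ᴹ_ = ≡-dec _≟ᴱ_ _≟ᴱ_
  where
  _≟ᴱ_ : ∀ {n} → DecidableEquality (EdgeMS n)
  ms E ≟ᴱ ms F = Dec.map′ (cong ms) (cong mults) (VecP.≡-dec ℕ._≟_ E F)

edgeCount : ∀ {n} → Marked n → ℕ
edgeCount (E , Ē) = size E + size Ē

orderings : ∀ {n} → Marked n → ℕ
orderings {n} G =
  length (filter (λ s → markedOf s ≟ᴹ G) (seqs (triples n) (edgeCount G)))

κ : ∀ {n} → Marked n → ℚ
κ G = ℚ._/_ (+ orderings G) (2 ^ m * m !)
  {{m*n≢0 (2 ^ m) (m !) {{m^n≢0 2 m}} {{m !≢0}}}}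
  where m = edgeCount G

_^ℚ_ : ℚ → ℕ → ℚ
q ^ℚ zero = ℚ.1ℚ
q ^ℚ suc e = q ℚ.* (q ^ℚ e)

-- Marked_𝓕(u,v) for a family 𝓕 of multigraphs on {1..n} with m edges:
-- sum over Marked(𝓕) of κ(G) u^{k(G)} v^{ℓ(G)}.  (Every element of 𝓕
-- has m edges, so Marked(𝓕) ⊆ markedAll n m.)

MarkedGF : (n m : ℕ) → Family n → ℚ → ℚ → ℚ
MarkedGF n m 𝓕 u v =
  foldr ℚ._+_ ℚ.0ℚ
    (map (λ G → κ G ℚ.* (u ^ℚ kk G) ℚ.* (v ^ℚ ℓ G))
         (filter (λ G → T? (isInMarked 𝓕 G)) (markedAll n m)))

card : (n m : ℕ) → Family n → ℕ
card n m 𝓕 = length (filter (λ E → T? (𝓕 E)) (multisets n m))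

module Submission where

-- Multiplying by 2^m m!, the left-hand side is the signed count
--   Σ_s weight (markedOf s)
-- over all sequences s of m triples (v , w , t), where weight G = (-1)^(k(G)+ℓ(G))
-- if G ∈ Marked(MG*) and 0 otherwise: every marked graph G with m edges is hit by
-- exactly orderings(G) sequences.
--
-- Call a pair p swappable in G if in E ∪ Ē it is a loop of multiplicity 1 or a
-- non-loop edge of multiplicity 2.  Exchanging the normal and the marked
-- multiplicity of p keeps G in Marked(MG*) and changes k+ℓ by one, so it flips the
-- weight; on sequences it is realised by toggling the mark bit of every triple on
-- p, a bijection.  Splitting each weight according to the first swappable pair, all
-- those parts cancel.  A marked graph of Marked(MG*) without swappable pair has no
-- marked edges and is simple, i.e. it is an element of SG with Ē = ∅, and such a
-- graph has exactly 2^m m! orderings.  So the signed count is |SG| · 2^m m!.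

open import Defs
open import Data.Bool as Bool using (Bool; true; false; _∧_; _∨_; not; if_then_else_; T; T?; _xor_)
import Data.Bool.Properties as BP
open import Data.Bool.ListAction using (all; any; or)
open import Data.Nat as ℕ using (ℕ; zero; suc; _+_; _*_; _≤_; _<_; _∸_; _≡ᵇ_; _≤ᵇ_; _^_; _!)
import Data.Nat.Properties as NP
open import Data.Nat.Properties using (m*n≢0; m^n≢0; _!≢0)
open import Data.Integer as ℤ using (ℤ)
import Data.Integer.Properties as ZP
open import Data.Rational as ℚ using (ℚ; _/_; -_; 1ℚ)
import Data.Rational.Properties as QP
open import Data.Rational.Unnormalised as ℚᵘ using (mkℚᵘ; _≃_; *≡*)
import Data.Rational.Unnormalised.Properties as QUP
open import Data.Fin as Fin using (Fin; toℕ)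
import Data.Fin.Properties as FP
open import Data.List as List using (List; []; _∷_; map; concatMap; filter; _++_; tabulate; allFin; applyUpTo; upTo; length; foldr; cartesianProduct)
import Data.List.Properties as LP
open import Data.Vec as Vec using (Vec; []; _∷_; lookup; _[_]≔_)
import Data.Vec.Properties as VP
open import Data.Maybe using (Maybe; just; nothing)
open import Data.Product using (_×_; _,_; proj₁; proj₂; Σ)
open import Data.Sum using (_⊎_; inj₁; inj₂)
open import Data.Empty using (⊥; ⊥-elim)
open import Function using (_∘_)
open import Function.Bundles using (mk⇔)
open import Relation.Nullary using (Dec; yes; no; does; ¬_)
open import Relation.Nullary.Decidable using (⌊_⌋; dec-true; dec-false; does-⇔)
open import Relation.Binary.PropositionalEquality
open import Relation.Binary.Definitions using (DecidableEquality)

Mults : ℕ → Set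
Mults n = Vec ℕ (P n)

does-true : ∀ {A : Set} (d : Dec A) → does d ≡ true → A
does-true (yes a) _ = a

⟦_⟧ : Bool → ℕ
⟦ b ⟧ = if b then 1 else 0

⟦∧⟧ : ∀ x y → ⟦ x ∧ y ⟧ ≡ ⟦ x ⟧ * ⟦ y ⟧
⟦∧⟧ true y = sym (NP.+-identityʳ ⟦ y ⟧)
⟦∧⟧ false y = refl

⟦∨⟧ : ∀ x y → (x ∧ y ≡ true → ⊥) → ⟦ x ∨ y ⟧ ≡ ⟦ x ⟧ + ⟦ y ⟧
⟦∨⟧ true true h = ⊥-elim (h refl)
⟦∨⟧ true false h = refl
⟦∨⟧ false y h = refl

∧-true : ∀ {a b} → a ∧ b ≡ true → a ≡ true × b ≡ true
∧-true {true} {true} _ = refl , refl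

∨-true : ∀ {a b} → a ∨ b ≡ true → a ≡ true ⊎ b ≡ true
∨-true {true} _ = inj₁ refl
∨-true {false} e = inj₂ e

∧-intro : ∀ {a b} → a ≡ true → b ≡ true → a ∧ b ≡ true
∧-intro refl refl = refl

∨-introˡ : ∀ {a} b → a ≡ true → a ∨ b ≡ true
∨-introˡ b refl = refl

∨-introʳ : ∀ a {b} → b ≡ true → a ∨ b ≡ true
∨-introʳ true _ = refl
∨-introʳ false e = e

t≢f : true ≢ false
t≢f ()

bool-ext : ∀ {a b : Bool} → (a ≡ true → b ≡ true) → (b ≡ true → a ≡ true) → a ≡ b
bool-ext {true} {true} f g = refl
bool-ext {true} {false} f g = sym (f refl)
bool-ext {false} {true} f g = g refl
bool-ext {false} {false} f g = refl

≡ᵇ⇒≡ : ∀ {a b} → (a ≡ᵇ b) ≡ true → a ≡ b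
≡ᵇ⇒≡ {a} {b} e = NP.≡ᵇ⇒≡ a b (subst T (sym e) _)

≡⇒≡ᵇ : ∀ a b → a ≡ b → (a ≡ᵇ b) ≡ true
≡⇒≡ᵇ a b e = dec-true (a ℕ.≟ b) e

≢⇒≡ᵇ : ∀ a b → a ≢ b → (a ≡ᵇ b) ≡ false
≢⇒≡ᵇ a b ne = dec-false (a ℕ.≟ b) ne

≡ᵇ-false⇒≢ : ∀ {a b} → (a ≡ᵇ b) ≡ false → a ≢ b
≡ᵇ-false⇒≢ {a} {b} e eq = subst T e (NP.≡⇒≡ᵇ a b eq)

≤ᵇ⇒≤ : ∀ {a b} → (a ≤ᵇ b) ≡ true → a ≤ b
≤ᵇ⇒≤ {a} {b} e = NP.≤ᵇ⇒≤ a b (subst T (sym e) _)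

≤⇒≤ᵇ : ∀ {a b} → a ≤ b → (a ≤ᵇ b) ≡ true
≤⇒≤ᵇ {a} {b} le with a ≤ᵇ b in eq
... | true = refl
... | false = ⊥-elim (subst T eq (NP.≤⇒≤ᵇ le))

=ᶠ⇒≡ : ∀ {n} {i j : Fin n} → i =ᶠ j ≡ true → i ≡ j
=ᶠ⇒≡ {i = i} {j} e with i Fin.≟ j
... | yes i≡j = i≡j

=ᶠ-refl : ∀ {n} (i : Fin n) → i =ᶠ i ≡ true
=ᶠ-refl i with i Fin.≟ i
... | yes _ = refl
... | no i≢i = ⊥-elim (i≢i refl)

≢⇒=ᶠ : ∀ {n} {i j : Fin n} → i ≢ j → i =ᶠ j ≡ false
≢⇒=ᶠ {i = i} {j} ne with i Fin.≟ j
... | yes i≡j = ⊥-elim (ne i≡j)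
... | no _ = refl

=ᶠ-false⇒≢ : ∀ {n} {i j : Fin n} → i =ᶠ j ≡ false → i ≢ j
=ᶠ-false⇒≢ {i = i} e refl with trans (sym (=ᶠ-refl i)) e
... | ()

=ᶠ-sym : ∀ {n} (a b : Fin n) → (a =ᶠ b) ≡ (b =ᶠ a)
=ᶠ-sym a b = bool-ext (λ e → subst (λ x → x =ᶠ a ≡ true) (=ᶠ⇒≡ e) (=ᶠ-refl a))
                      (λ e → subst (λ x → x =ᶠ b ≡ true) (=ᶠ⇒≡ e) (=ᶠ-refl b))

all-tabulate⇒ : ∀ {A : Set} {k} (g : Fin k → A) (f : A → Bool) → all f (tabulate g) ≡ true → ∀ i → f (g i) ≡ true
all-tabulate⇒ {k = suc k} g f e Fin.zero = proj₁ (∧-true e)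
all-tabulate⇒ {k = suc k} g f e (Fin.suc i) = all-tabulate⇒ (g ∘ Fin.suc) f (proj₂ (∧-true {f (g Fin.zero)} e)) i

⇒all-tabulate : ∀ {A : Set} {k} (g : Fin k → A) (f : A → Bool) → (∀ i → f (g i) ≡ true) → all f (tabulate g) ≡ true
⇒all-tabulate {k = zero} g f h = refl
⇒all-tabulate {k = suc k} g f h = ∧-intro (h Fin.zero) (⇒all-tabulate (g ∘ Fin.suc) f (h ∘ Fin.suc))

any-tabulate⇒ : ∀ {A : Set} {k} (g : Fin k → A) (f : A → Bool) → any f (tabulate g) ≡ true → Σ (Fin k) (λ i → f (g i) ≡ true)
any-tabulate⇒ {k = suc k} g f e with f (g Fin.zero) in eq
... | true = Fin.zero , eq
... | false with any-tabulate⇒ (g ∘ Fin.suc) f e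
... | i , fi = Fin.suc i , fi

⇒any-tabulate : ∀ {A : Set} {k} (g : Fin k → A) (f : A → Bool) (i : Fin k) → f (g i) ≡ true → any f (tabulate g) ≡ true
⇒any-tabulate {k = suc k} g f Fin.zero e = ∨-introˡ _ e
⇒any-tabulate {k = suc k} g f (Fin.suc i) e = ∨-introʳ (f (g Fin.zero)) (⇒any-tabulate (g ∘ Fin.suc) f i e)

allV-elim : ∀ {n} {f : Fin n → Bool} → allV n f ≡ true → ∀ v → f v ≡ true
allV-elim {f = f} = all-tabulate⇒ (λ x → x) f

allV-intro : ∀ {n} {f : Fin n → Bool} → (∀ v → f v ≡ true) → allV n f ≡ true
allV-intro {f = f} = ⇒all-tabulate (λ x → x) f

anyV-elim : ∀ {n} {f : Fin n → Bool} → anyV n f ≡ true → Σ (Fin n) (λ v → f v ≡ true)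
anyV-elim {f = f} = any-tabulate⇒ (λ x → x) f

anyV-intro : ∀ {n} {f : Fin n → Bool} v → f v ≡ true → anyV n f ≡ true
anyV-intro {f = f} = ⇒any-tabulate (λ x → x) f

anyV-cong : ∀ {n} {f g : Fin n → Bool} → (∀ v → f v ≡ g v) → anyV n f ≡ anyV n g
anyV-cong {n} h = cong or (LP.map-cong h (allFin n))

module Sums {A : Set} (_⊕_ : A → A → A) (_⊗_ : A → A → A) (ε : A)
  (assoc : ∀ x y z → (x ⊕ y) ⊕ z ≡ x ⊕ (y ⊕ z))
  (comm : ∀ x y → x ⊕ y ≡ y ⊕ x)
  (idl : ∀ x → ε ⊕ x ≡ x)
  (distl : ∀ c x y → c ⊗ (x ⊕ y) ≡ (c ⊗ x) ⊕ (c ⊗ y))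
  (zeror : ∀ c → c ⊗ ε ≡ ε) where

  idr : ∀ x → x ⊕ ε ≡ x
  idr x = trans (comm x ε) (idl x)

  interchange : ∀ a b c d → (a ⊕ b) ⊕ (c ⊕ d) ≡ (a ⊕ c) ⊕ (b ⊕ d)
  interchange a b c d =
    trans (assoc a b (c ⊕ d)) (trans (cong (a ⊕_) (trans (sym (assoc b c d))
      (trans (cong (_⊕ d) (comm b c)) (assoc c b d)))) (sym (assoc a c (b ⊕ d))))

  ΣL : {B : Set} → List B → (B → A) → A
  ΣL [] f = ε
  ΣL (x ∷ xs) f = f x ⊕ ΣL xs f

  ΣF : (k : ℕ) → (Fin k → A) → A
  ΣF zero f = ε
  ΣF (suc k) f = f Fin.zero ⊕ ΣF k (f ∘ Fin.suc)

  module _ {B : Set} where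
    ΣL-cong : ∀ (xs : List B) {f g : B → A} → (∀ x → f x ≡ g x) → ΣL xs f ≡ ΣL xs g
    ΣL-cong [] e = refl
    ΣL-cong (x ∷ xs) e = cong₂ _⊕_ (e x) (ΣL-cong xs e)

    ΣL-++ : ∀ (xs ys : List B) (f : B → A) → ΣL (xs ++ ys) f ≡ ΣL xs f ⊕ ΣL ys f
    ΣL-++ [] ys f = sym (idl _)
    ΣL-++ (x ∷ xs) ys f = trans (cong (f x ⊕_) (ΣL-++ xs ys f)) (sym (assoc _ _ _))

    ΣL-⊕ : ∀ (xs : List B) (f g : B → A) → ΣL xs (λ x → f x ⊕ g x) ≡ ΣL xs f ⊕ ΣL xs g
    ΣL-⊕ [] f g = sym (idl ε)
    ΣL-⊕ (x ∷ xs) f g = trans (cong (_ ⊕_) (ΣL-⊕ xs f g)) (interchange _ _ _ _)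

    ΣL-ε : ∀ (xs : List B) → ΣL xs (λ _ → ε) ≡ ε
    ΣL-ε [] = refl
    ΣL-ε (x ∷ xs) = trans (idl _) (ΣL-ε xs)

    ΣL-zero : ∀ (xs : List B) (f : B → A) → (∀ x → f x ≡ ε) → ΣL xs f ≡ ε
    ΣL-zero xs f e = trans (ΣL-cong xs e) (ΣL-ε xs)

    ΣL-scal : ∀ (xs : List B) (c : A) (f : B → A) → ΣL xs (λ x → c ⊗ f x) ≡ c ⊗ ΣL xs f
    ΣL-scal [] c f = sym (zeror c)
    ΣL-scal (x ∷ xs) c f = trans (cong (_ ⊕_) (ΣL-scal xs c f)) (sym (distl c _ _))

    ΣL-filter : ∀ {P : B → Set} (P? : ∀ x → Dec (P x)) (xs : List B) (f : B → A) →
      ΣL (filter P? xs) f ≡ ΣL xs (λ x → if does (P? x) then f x else ε)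
    ΣL-filter P? [] f = refl
    ΣL-filter P? (x ∷ xs) f with does (P? x)
    ... | true = cong (f x ⊕_) (ΣL-filter P? xs f)
    ... | false = trans (ΣL-filter P? xs f) (sym (idl _))

  ΣL-map : ∀ {B C : Set} (h : B → C) (xs : List B) (f : C → A) → ΣL (map h xs) f ≡ ΣL xs (f ∘ h)
  ΣL-map h [] f = refl
  ΣL-map h (x ∷ xs) f = cong (_ ⊕_) (ΣL-map h xs f)

  ΣL-concatMap : ∀ {B C : Set} (h : B → List C) (xs : List B) (f : C → A) →
    ΣL (concatMap h xs) f ≡ ΣL xs (λ x → ΣL (h x) f)
  ΣL-concatMap h [] f = refl
  ΣL-concatMap h (x ∷ xs) f = trans (ΣL-++ (h x) (concatMap h xs) f) (cong (_ ⊕_) (ΣL-concatMap h xs f))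

  ΣL-swap : ∀ {B C : Set} (xs : List B) (ys : List C) (f : B → C → A) →
    ΣL xs (λ x → ΣL ys (f x)) ≡ ΣL ys (λ y → ΣL xs (λ x → f x y))
  ΣL-swap [] ys f = sym (ΣL-ε ys)
  ΣL-swap (x ∷ xs) ys f = trans (cong (ΣL ys (f x) ⊕_) (ΣL-swap xs ys f)) (sym (ΣL-⊕ ys (f x) (λ y → ΣL xs (λ x → f x y))))

  ΣL-cart : ∀ {B C : Set} (xs : List B) (ys : List C) (f : B × C → A) →
    ΣL (cartesianProduct xs ys) f ≡ ΣL xs (λ x → ΣL ys (λ y → f (x , y)))
  ΣL-cart [] ys f = refl
  ΣL-cart (x ∷ xs) ys f = trans (ΣL-++ (map (x ,_) ys) _ f)
    (cong₂ _⊕_ (ΣL-map (x ,_) ys f) (ΣL-cart xs ys f))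

  ΣL-tabulate : ∀ {B : Set} (k : ℕ) (h : Fin k → B) (f : B → A) → ΣL (tabulate h) f ≡ ΣF k (f ∘ h)
  ΣL-tabulate zero h f = refl
  ΣL-tabulate (suc k) h f = cong (_ ⊕_) (ΣL-tabulate k (h ∘ Fin.suc) f)

  ΣL-allFin : ∀ (k : ℕ) (f : Fin k → A) → ΣL (allFin k) f ≡ ΣF k f
  ΣL-allFin k f = ΣL-tabulate k (λ x → x) f

  ΣF-cong : ∀ (k : ℕ) {f g : Fin k → A} → (∀ x → f x ≡ g x) → ΣF k f ≡ ΣF k g
  ΣF-cong zero e = refl
  ΣF-cong (suc k) e = cong₂ _⊕_ (e Fin.zero) (ΣF-cong k (e ∘ Fin.suc))

  ΣF-⊕ : ∀ (k : ℕ) (f g : Fin k → A) → ΣF k (λ x → f x ⊕ g x) ≡ ΣF k f ⊕ ΣF k g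
  ΣF-⊕ zero f g = sym (idl ε)
  ΣF-⊕ (suc k) f g = trans (cong (_ ⊕_) (ΣF-⊕ k (f ∘ Fin.suc) (g ∘ Fin.suc))) (interchange _ _ _ _)

  ΣF-ε : ∀ (k : ℕ) → ΣF k (λ _ → ε) ≡ ε
  ΣF-ε zero = refl
  ΣF-ε (suc k) = trans (idl _) (ΣF-ε k)

  ΣF-zero : ∀ (k : ℕ) (f : Fin k → A) → (∀ x → f x ≡ ε) → ΣF k f ≡ ε
  ΣF-zero k f e = trans (ΣF-cong k e) (ΣF-ε k)

  ΣF-scal : ∀ (k : ℕ) (c : A) (f : Fin k → A) → ΣF k (λ x → c ⊗ f x) ≡ c ⊗ ΣF k f
  ΣF-scal zero c f = sym (zeror c)
  ΣF-scal (suc k) c f = trans (cong (_ ⊕_) (ΣF-scal k c (f ∘ Fin.suc))) (sym (distl c _ _))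

  ΣF-swap : ∀ (k l : ℕ) (f : Fin k → Fin l → A) →
    ΣF k (λ x → ΣF l (f x)) ≡ ΣF l (λ y → ΣF k (λ x → f x y))
  ΣF-swap zero l f = sym (ΣF-ε l)
  ΣF-swap (suc k) l f = trans (cong (ΣF l (f Fin.zero) ⊕_) (ΣF-swap k l (f ∘ Fin.suc))) (sym (ΣF-⊕ l (f Fin.zero) (λ y → ΣF k (λ x → f (Fin.suc x) y))))

  ΣF-single : ∀ (k : ℕ) (f : Fin k → A) (p : Fin k) → (∀ q → q ≢ p → f q ≡ ε) → ΣF k f ≡ f p
  ΣF-single (suc k) f Fin.zero e =
    trans (cong (f Fin.zero ⊕_) (ΣF-zero k (f ∘ Fin.suc) (λ q → e (Fin.suc q) (λ ())))) (idr (f Fin.zero))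
  ΣF-single (suc k) f (Fin.suc p) e =
    trans (cong (_⊕ ΣF k (f ∘ Fin.suc)) (e Fin.zero (λ ()))) (trans (idl (ΣF k (f ∘ Fin.suc)))
      (ΣF-single k (f ∘ Fin.suc) p (λ q q≢p → e (Fin.suc q) (λ eq → q≢p (FP.suc-injective eq)))))

  ΣF-split : ∀ (k : ℕ) (f : Fin k → A) (p : Fin k) →
    ΣF k f ≡ f p ⊕ ΣF k (λ q → if does (q Fin.≟ p) then ε else f q)
  ΣF-split (suc k) f Fin.zero =
    cong (f Fin.zero ⊕_) (sym (trans (idl _) (ΣF-cong k (λ q → refl))))
  ΣF-split (suc k) f (Fin.suc p) = begin
      f Fin.zero ⊕ ΣF k (f ∘ Fin.suc)
    ≡⟨ cong (f Fin.zero ⊕_) (ΣF-split k (f ∘ Fin.suc) p) ⟩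
      f Fin.zero ⊕ (f (Fin.suc p) ⊕ R)
    ≡⟨ sym (assoc _ _ _) ⟩
      (f Fin.zero ⊕ f (Fin.suc p)) ⊕ R
    ≡⟨ cong (_⊕ R) (comm _ _) ⟩
      (f (Fin.suc p) ⊕ f Fin.zero) ⊕ R
    ≡⟨ assoc _ _ _ ⟩
      f (Fin.suc p) ⊕ (f Fin.zero ⊕ R)
    ≡⟨ cong (λ z → f (Fin.suc p) ⊕ (f Fin.zero ⊕ z)) (ΣF-cong k shift) ⟩
      f (Fin.suc p) ⊕ (f Fin.zero ⊕ ΣF k (λ q → if does (Fin.suc q Fin.≟ Fin.suc p) then ε else f (Fin.suc q)))
    ∎
    where
    open ≡-Reasoning
    R : A
    R = ΣF k (λ q → if does (q Fin.≟ p) then ε else f (Fin.suc q))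
    shift : ∀ q → (if does (q Fin.≟ p) then ε else f (Fin.suc q)) ≡
                  (if does (Fin.suc q Fin.≟ Fin.suc p) then ε else f (Fin.suc q))
    shift q = cong (λ b → if b then ε else f (Fin.suc q))
                   (does-⇔ (mk⇔ (cong Fin.suc) FP.suc-injective) (q Fin.≟ p) (Fin.suc q Fin.≟ Fin.suc p))

module Σℕ = Sums ℕ._+_ ℕ._*_ 0 NP.+-assoc NP.+-comm (λ _ → refl) NP.*-distribˡ-+ NP.*-zeroʳ
module Σℤ = Sums ℤ._+_ ℤ._*_ (ℤ.+ 0) ZP.+-assoc ZP.+-comm ZP.+-identityˡ ZP.*-distribˡ-+ ZP.*-zeroʳ
open Σℕ using (ΣF; ΣL)

ΣF-update : ∀ k (f g : Fin k → ℕ) p → (∀ q → q ≢ p → f q ≡ g q) → ΣF k f + g p ≡ ΣF k g + f p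
ΣF-update k f g p h = begin
    ΣF k f + g p
  ≡⟨ cong (_+ g p) (Σℕ.ΣF-split k f p) ⟩
    (f p + Rf) + g p
  ≡⟨ cong (λ z → (f p + z) + g p) (Σℕ.ΣF-cong k agree) ⟩
    (f p + Rg) + g p
  ≡⟨ exchange ⟩
    (g p + Rg) + f p
  ≡⟨ cong (_+ f p) (sym (Σℕ.ΣF-split k g p)) ⟩
    ΣF k g + f p
  ∎
  where
  open ≡-Reasoning
  Rf Rg : ℕ
  Rf = ΣF k (λ q → if does (q Fin.≟ p) then 0 else f q)
  Rg = ΣF k (λ q → if does (q Fin.≟ p) then 0 else g q)
  agree : ∀ q → (if does (q Fin.≟ p) then 0 else f q) ≡ (if does (q Fin.≟ p) then 0 else g q)
  agree q with q Fin.≟ p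
  ... | yes _ = refl
  ... | no ne = h q ne
  exchange : (f p + Rg) + g p ≡ (g p + Rg) + f p
  exchange = trans (NP.+-assoc (f p) Rg (g p)) (trans (NP.+-comm (f p) (Rg + g p))
               (cong (_+ f p) (NP.+-comm Rg (g p))))

ΣF-ge1 : ∀ k (f : Fin k → ℕ) p → f p ≤ ΣF k f
ΣF-ge1 k f p = subst (f p ≤_) (sym (Σℕ.ΣF-split k f p)) (NP.m≤m+n _ _)

ΣF-ge2 : ∀ k (f : Fin k → ℕ) p q → q ≢ p → f p + f q ≤ ΣF k f
ΣF-ge2 k f p q q≢p = subst (f p + f q ≤_) (sym (Σℕ.ΣF-split k f p))
  (NP.+-monoʳ-≤ (f p) (subst (_≤ ΣF k (λ q' → if does (q' Fin.≟ p) then 0 else f q'))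
     entry-q (ΣF-ge1 k _ q)))
  where
  entry-q : (if does (q Fin.≟ p) then 0 else f q) ≡ f q
  entry-q = cong (λ b → if b then 0 else f q) (dec-false (q Fin.≟ p) q≢p)

ΣF-zeros : ∀ k (f : Fin k → ℕ) → ΣF k f ≡ 0 → ∀ q → f q ≡ 0
ΣF-zeros k f e q = NP.n≤0⇒n≡0 (subst (f q ≤_) e (ΣF-ge1 k f q))

vec-ext : ∀ {A : Set} {k} (xs ys : Vec A k) → (∀ i → lookup xs i ≡ lookup ys i) → xs ≡ ys
vec-ext [] [] e = refl
vec-ext (x ∷ xs) (y ∷ ys) e = cong₂ _∷_ (e Fin.zero) (vec-ext xs ys (e ∘ Fin.suc))

sum-ΣF : ∀ {k} (xs : Vec ℕ k) → Vec.sum xs ≡ ΣF k (lookup xs)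
sum-ΣF [] = refl
sum-ΣF (x ∷ xs) = cong (x +_) (sum-ΣF xs)

sum-zipWith-ΣF : ∀ {B C : Set} {k} (f : B → C → ℕ) (xs : Vec B k) (ys : Vec C k) →
  Vec.sum (Vec.zipWith f xs ys) ≡ ΣF k (λ q → f (lookup xs q) (lookup ys q))
sum-zipWith-ΣF f [] [] = refl
sum-zipWith-ΣF f (x ∷ xs) (y ∷ ys) = cong (f x y +_) (sum-zipWith-ΣF f xs ys)

sum-map-ΣF : ∀ {B : Set} {k} (f : B → ℕ) (xs : Vec B k) →
  Vec.sum (Vec.map f xs) ≡ ΣF k (λ q → f (lookup xs q))
sum-map-ΣF f [] = refl
sum-map-ΣF f (x ∷ xs) = cong (f x +_) (sum-map-ΣF f xs)

ΣF-fromList : ∀ {B : Set} (xs : List B) (g : B → ℕ) →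
  ΣF (List.length xs) (λ q → g (lookup (Vec.fromList xs) q)) ≡ ΣL xs g
ΣF-fromList [] g = refl
ΣF-fromList (x ∷ xs) g = cong (g x +_) (ΣF-fromList xs g)

length-filter : ∀ {A : Set} {P : A → Set} (P? : ∀ x → Dec (P x)) (xs : List A) →
  length (filter P? xs) ≡ ΣL xs (λ x → ⟦ does (P? x) ⟧)
length-filter P? [] = refl
length-filter P? (x ∷ xs) with does (P? x)
... | true = cong suc (length-filter P? xs)
... | false = length-filter P? xs

+-ΣL : ∀ {A : Set} (xs : List A) (f : A → ℕ) → ℤ.+ (ΣL xs f) ≡ Σℤ.ΣL xs (λ x → ℤ.+ f x)
+-ΣL [] f = refl
+-ΣL (x ∷ xs) f = trans (ZP.pos-+ (f x) (ΣL xs f)) (cong (ℤ._+_ (ℤ.+ f x)) (+-ΣL xs f))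

ΣL-neg : ∀ {A : Set} (xs : List A) (f : A → ℤ) → Σℤ.ΣL xs (λ x → ℤ.- f x) ≡ ℤ.- Σℤ.ΣL xs f
ΣL-neg [] f = refl
ΣL-neg (x ∷ xs) f = trans (cong (ℤ._+_ (ℤ.- f x)) (ΣL-neg xs f)) (sym (ZP.neg-distrib-+ (f x) (Σℤ.ΣL xs f)))

unique-of-count-one : ∀ (k : ℕ) (f : Fin k → Bool) → ΣF k (λ q → ⟦ f q ⟧) ≡ 1 →
  Σ (Fin k) (λ p → f p ≡ true × (∀ q → f q ≡ true → q ≡ p))
unique-of-count-one zero f ()
unique-of-count-one (suc k) f e with f Fin.zero in eq0
... | true = Fin.zero , eq0 , uniq
  where
  others-zero : ∀ q → ⟦ f (Fin.suc q) ⟧ ≡ 0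
  others-zero = ΣF-zeros k (λ q → ⟦ f (Fin.suc q) ⟧) (NP.suc-injective e)
  uniq : ∀ q → f q ≡ true → q ≡ Fin.zero
  uniq Fin.zero _ = refl
  uniq (Fin.suc q) t with trans (cong ⟦_⟧ (sym t)) (others-zero q)
  ... | ()
... | false with unique-of-count-one k (f ∘ Fin.suc) e
... | p , fp , u = Fin.suc p , fp , uniq
  where
  uniq : ∀ q → f q ≡ true → q ≡ Fin.suc p
  uniq Fin.zero t with trans (sym t) eq0
  ... | ()
  uniq (Fin.suc q) t = cong Fin.suc (u q t)

-- Indices of unordered pairs.

rep-true : ∀ {n} (i j v w : Fin n) → represents (i , j) v w ≡ true → (i ≡ v × j ≡ w) ⊎ (i ≡ w × j ≡ v)
rep-true i j v w e with ∨-true {i =ᶠ v ∧ j =ᶠ w} e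
... | inj₁ e1 = let (a , b) = ∧-true e1 in inj₁ (=ᶠ⇒≡ a , =ᶠ⇒≡ b)
... | inj₂ e2 = let (a , b) = ∧-true e2 in inj₂ (=ᶠ⇒≡ a , =ᶠ⇒≡ b)

rep-self : ∀ {n} (i j : Fin n) → represents (i , j) i j ≡ true
rep-self i j rewrite =ᶠ-refl i | =ᶠ-refl j = refl

rep-sym : ∀ {n} (p : Fin n × Fin n) v w → represents p v w ≡ represents p w v
rep-sym (i , j) v w = BP.∨-comm (i =ᶠ v ∧ j =ᶠ w) (i =ᶠ w ∧ j =ᶠ v)

rep-swap : ∀ {n} (i j : Fin n) → represents (i , j) j i ≡ true
rep-swap i j = trans (rep-sym (i , j) j i) (rep-self i j)

module _ {n : ℕ} where
  pr : Fin (P n) → Fin n × Fin n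
  pr q = lookup (pairs n) q

  private
    record OrderedRep (v w : Fin n) : Set where
      field
        a b : Fin n
        a≤b : toℕ a ℕ.≤ toℕ b
        repab : represents (a , b) v w ≡ true
        uniq : ∀ i j → toℕ i ℕ.≤ toℕ j → represents (i , j) v w ≡ true → i ≡ a × j ≡ b

    orderedRep : ∀ v w → OrderedRep v w
    orderedRep v w with toℕ v ℕ.≤? toℕ w
    ... | yes v≤w = record { a = v ; b = w ; a≤b = v≤w ; repab = rep-self v w ; uniq = u }
      where
      u : ∀ i j → toℕ i ℕ.≤ toℕ j → represents (i , j) v w ≡ true → i ≡ v × j ≡ w
      u i j i≤j r with rep-true i j v w r
      ... | inj₁ (refl , refl) = refl , refl
      ... | inj₂ (refl , refl) = let e = FP.toℕ-injective (NP.≤-antisym v≤w i≤j) in sym e , e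
    ... | no v≰w = record { a = w ; b = v ; a≤b = NP.≰⇒≥ v≰w ; repab = rep-swap w v ; uniq = u }
      where
      u : ∀ i j → toℕ i ℕ.≤ toℕ j → represents (i , j) v w ≡ true → i ≡ w × j ≡ v
      u i j i≤j r with rep-true i j v w r
      ... | inj₁ (refl , refl) = ⊥-elim (v≰w i≤j)
      ... | inj₂ (refl , refl) = refl , refl

  -- the term of the double sum over i ≤ j that enumerates `pairs n`
  countTerm : Fin n → Fin n → Fin n → Fin n → ℕ
  countTerm v w i j = if toℕ i ℕ.≤ᵇ toℕ j then ⟦ represents (i , j) v w ⟧ else 0

  represented-once : ∀ v w → ΣF (P n) (λ q → ⟦ represents (pr q) v w ⟧) ≡ 1
  represented-once v w = begin
      ΣF (P n) (λ q → ⟦ represents (pr q) v w ⟧)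
    ≡⟨ ΣF-fromList (pairsL n) g ⟩
      ΣL (pairsL n) g
    ≡⟨ Σℕ.ΣL-concatMap _ (allFin n) g ⟩
      ΣL (allFin n) (λ i → ΣL (map (λ j → i , j) (filter (λ j → toℕ i ℕ.≤? toℕ j) (allFin n))) g)
    ≡⟨ Σℕ.ΣL-cong (allFin n) (λ i → trans (Σℕ.ΣL-map (λ j → i , j) (filter (λ j → toℕ i ℕ.≤? toℕ j) (allFin n)) g) (Σℕ.ΣL-filter (λ j → toℕ i ℕ.≤? toℕ j) (allFin n) (λ j → g (i , j)))) ⟩
      ΣL (allFin n) (λ i → ΣL (allFin n) (countTerm v w i))
    ≡⟨ trans (Σℕ.ΣL-allFin n _) (Σℕ.ΣF-cong n (λ i → Σℕ.ΣL-allFin n _)) ⟩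
      ΣF n (λ i → ΣF n (countTerm v w i))
    ≡⟨ Σℕ.ΣF-single n _ a (λ i i≢a → Σℕ.ΣF-zero n _ (λ j → off i j (inj₁ i≢a))) ⟩
      ΣF n (countTerm v w a)
    ≡⟨ Σℕ.ΣF-single n _ b (λ j j≢b → off a j (inj₂ j≢b)) ⟩
      countTerm v w a b
    ≡⟨ one ⟩
      1
    ∎
    where
    open ≡-Reasoning
    g : Fin n × Fin n → ℕ
    g p = ⟦ represents p v w ⟧
    open OrderedRep (orderedRep v w)
    off : ∀ i j → (i ≢ a ⊎ j ≢ b) → countTerm v w i j ≡ 0
    off i j ne with toℕ i ℕ.≤ᵇ toℕ j in eb | represents (i , j) v w in er
    ... | false | _ = refl
    ... | true | false = refl
    ... | true | true with uniq i j (NP.≤ᵇ⇒≤ _ _ (subst T (sym eb) _)) er | ne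
    ... | (e1 , e2) | inj₁ x = ⊥-elim (x e1)
    ... | (e1 , e2) | inj₂ x = ⊥-elim (x e2)
    one : countTerm v w a b ≡ 1
    one rewrite repab with toℕ a ℕ.≤ᵇ toℕ b in eb
    ... | true = refl
    ... | false = ⊥-elim (subst T eb (NP.≤⇒≤ᵇ a≤b))

  index-spec : ∀ v w → Σ (Fin (P n)) (λ p → represents (pr p) v w ≡ true × (∀ q → represents (pr q) v w ≡ true → q ≡ p))
  index-spec v w = unique-of-count-one (P n) (λ q → represents (pr q) v w) (represented-once v w)

  -- The index of {v , w}.  It is kept opaque: only its specification is used.
  opaque
    idx : Fin n → Fin n → Fin (P n)
    idx v w = proj₁ (index-spec v w)

    idx-rep : ∀ v w → represents (pr (idx v w)) v w ≡ true
    idx-rep v w = proj₁ (proj₂ (index-spec v w))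

    idx-uniq : ∀ v w q → represents (pr q) v w ≡ true → q ≡ idx v w
    idx-uniq v w = proj₂ (proj₂ (index-spec v w))

  idx-sym : ∀ v w → idx v w ≡ idx w v
  idx-sym v w = idx-uniq w v (idx v w) (trans (rep-sym (pr (idx v w)) w v) (idx-rep v w))

  pr-idx : ∀ v w → (pr (idx v w) ≡ (v , w)) ⊎ (pr (idx v w) ≡ (w , v))
  pr-idx v w with pr (idx v w) | idx-rep v w
  ... | (i , j) | r with rep-true i j v w r
  ... | inj₁ (refl , refl) = inj₁ refl
  ... | inj₂ (refl , refl) = inj₂ refl

  idx-pr : ∀ q → q ≡ idx (proj₁ (pr q)) (proj₂ (pr q))
  idx-pr q = idx-uniq _ _ q (rep-self (proj₁ (pr q)) (proj₂ (pr q)))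

  idx-inj : ∀ v w x y → idx v w ≡ idx x y → (v ≡ x × w ≡ y) ⊎ (v ≡ y × w ≡ x)
  idx-inj v w x y e = from (pr-idx v w)
    where
    rep-xy : represents (pr (idx v w)) x y ≡ true
    rep-xy = subst (λ q → represents (pr q) x y ≡ true) (sym e) (idx-rep x y)
    from : (pr (idx v w) ≡ (v , w)) ⊎ (pr (idx v w) ≡ (w , v)) → (v ≡ x × w ≡ y) ⊎ (v ≡ y × w ≡ x)
    from (inj₁ eq) = rep-true v w x y (subst (λ p → represents p x y ≡ true) eq rep-xy)
    from (inj₂ eq) with rep-true w v x y (subst (λ p → represents p x y ≡ true) eq rep-xy)
    ... | inj₁ (w≡x , v≡y) = inj₂ (v≡y , w≡x)
    ... | inj₂ (w≡y , v≡x) = inj₁ (v≡x , w≡y)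

  mult-lookup : ∀ (E : Mults n) v w → mult (ms E) v w ≡ lookup E (idx v w)
  mult-lookup E v w = trans (sum-zipWith-ΣF _ (pairs n) E)
    (trans (Σℕ.ΣF-single (P n) _ (idx v w) off) at-idx)
    where
    off : ∀ q → q ≢ idx v w → (if represents (pr q) v w then lookup E q else 0) ≡ 0
    off q q≢ with represents (pr q) v w in er
    ... | true = ⊥-elim (q≢ (idx-uniq v w q er))
    ... | false = refl
    at-idx : (if represents (pr (idx v w)) v w then lookup E (idx v w) else 0) ≡ lookup E (idx v w)
    at-idx rewrite idx-rep v w = refl

occurrences : ∀ {K : Set} → DecidableEquality K → K → List K → ℕ
occurrences eq? k L = Σℕ.ΣL L (λ G → ⟦ does (eq? k G) ⟧)

fibre-sum : ∀ {S K : Set} (eq? : DecidableEquality K) (L : List K) (xs : List S) (f : S → K) (h : K → ℤ) →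
  (∀ s → h (f s) ≡ ℤ.+ 0 ⊎ occurrences eq? (f s) L ≡ 1) →
  Σℤ.ΣL L (λ G → h G ℤ.* ℤ.+ (length (filter (λ s → eq? (f s) G) xs))) ≡ Σℤ.ΣL xs (λ s → h (f s))
fibre-sum eq? L xs f h cond = begin
    Σℤ.ΣL L (λ G → h G ℤ.* ℤ.+ (length (filter (λ s → eq? (f s) G) xs)))
  ≡⟨ Σℤ.ΣL-cong L (λ G → cong (λ z → h G ℤ.* z) (trans (cong ℤ.+_ (length-filter _ xs)) (+-ΣL xs _))) ⟩
    Σℤ.ΣL L (λ G → h G ℤ.* Σℤ.ΣL xs (λ s → ℤ.+ ⟦ does (eq? (f s) G) ⟧))
  ≡⟨ Σℤ.ΣL-cong L (λ G → sym (Σℤ.ΣL-scal xs (h G) _)) ⟩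
    Σℤ.ΣL L (λ G → Σℤ.ΣL xs (λ s → h G ℤ.* ℤ.+ ⟦ does (eq? (f s) G) ⟧))
  ≡⟨ Σℤ.ΣL-swap L xs _ ⟩
    Σℤ.ΣL xs (λ s → Σℤ.ΣL L (λ G → h G ℤ.* ℤ.+ ⟦ does (eq? (f s) G) ⟧))
  ≡⟨ Σℤ.ΣL-cong xs (λ s → Σℤ.ΣL-cong L (only-own-fibre s)) ⟩
    Σℤ.ΣL xs (λ s → Σℤ.ΣL L (λ G → h (f s) ℤ.* ℤ.+ ⟦ does (eq? (f s) G) ⟧))
  ≡⟨ Σℤ.ΣL-cong xs (λ s → trans (Σℤ.ΣL-scal L (h (f s)) _) (cong (h (f s) ℤ.*_) (sym (+-ΣL L _)))) ⟩
    Σℤ.ΣL xs (λ s → h (f s) ℤ.* ℤ.+ occurrences eq? (f s) L)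
  ≡⟨ Σℤ.ΣL-cong xs occurs-once ⟩
    Σℤ.ΣL xs (λ s → h (f s))
  ∎
  where
  open ≡-Reasoning
  only-own-fibre : ∀ s G → h G ℤ.* ℤ.+ ⟦ does (eq? (f s) G) ⟧ ≡ h (f s) ℤ.* ℤ.+ ⟦ does (eq? (f s) G) ⟧
  only-own-fibre s G with eq? (f s) G
  ... | yes refl = refl
  ... | no _ = trans (ZP.*-zeroʳ (h G)) (sym (ZP.*-zeroʳ (h (f s))))
  occurs-once : ∀ s → h (f s) ℤ.* ℤ.+ occurrences eq? (f s) L ≡ h (f s)
  occurs-once s with cond s
  ... | inj₁ z rewrite z = refl
  ... | inj₂ o rewrite o = ZP.*-identityʳ (h (f s))

seqs-map-invariant : ∀ {A : Set} (xs : List A) (σ : A → A) → (∀ g → Σℤ.ΣL xs (g ∘ σ) ≡ Σℤ.ΣL xs g) →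
  ∀ m (F : Vec A m → ℤ) → Σℤ.ΣL (seqs xs m) (F ∘ Vec.map σ) ≡ Σℤ.ΣL (seqs xs m) F
seqs-map-invariant xs σ inv zero F = refl
seqs-map-invariant xs σ inv (suc m) F = begin
    Σℤ.ΣL (seqs xs (suc m)) (F ∘ Vec.map σ)
  ≡⟨ Σℤ.ΣL-concatMap (λ x → map (x ∷_) (seqs xs m)) xs (F ∘ Vec.map σ) ⟩
    Σℤ.ΣL xs (λ x → Σℤ.ΣL (map (x ∷_) (seqs xs m)) (F ∘ Vec.map σ))
  ≡⟨ Σℤ.ΣL-cong xs (λ x → trans (Σℤ.ΣL-map (x ∷_) (seqs xs m) (F ∘ Vec.map σ))
                                (seqs-map-invariant xs σ inv m (λ s → F (σ x ∷ s)))) ⟩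
    Σℤ.ΣL xs (λ x → Σℤ.ΣL (seqs xs m) (λ s → F (σ x ∷ s)))
  ≡⟨ inv (λ y → Σℤ.ΣL (seqs xs m) (λ s → F (y ∷ s))) ⟩
    Σℤ.ΣL xs (λ x → Σℤ.ΣL (seqs xs m) (λ s → F (x ∷ s)))
  ≡⟨ Σℤ.ΣL-cong xs (λ x → sym (Σℤ.ΣL-map (x ∷_) (seqs xs m) F)) ⟩
    Σℤ.ΣL xs (λ x → Σℤ.ΣL (map (x ∷_) (seqs xs m)) F)
  ≡⟨ sym (Σℤ.ΣL-concatMap (λ x → map (x ∷_) (seqs xs m)) xs F) ⟩
    Σℤ.ΣL (seqs xs (suc m)) F
  ∎
  where open ≡-Reasoning

-- Toggling marks.  Exchanging the normal and the marked multiplicity of one pair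
-- p (swapMarks p) is realised on sequences of triples by flipping the mark bit of
-- every triple lying on p (toggle p).  Toggling is a bijection of the triples, so
-- it leaves sums over sequences unchanged.

module _ {n : ℕ} where

  toggle : Fin (P n) → Triple n → Triple n
  toggle p (v , w , b) = v , w , (b xor represents (pr p) v w)

  swapMarks : Fin (P n) → Marked n → Marked n
  swapMarks p (ms E , ms Ē) = ms (E [ p ]≔ lookup Ē p) , ms (Ē [ p ]≔ lookup E p)

  hits : Bool → Fin n × Fin n → Triple n → ℕ
  hits t pp x = if represents pp (proj₁ x) (proj₁ (proj₂ x)) ∧ ⌊ proj₂ (proj₂ x) Bool.≟ t ⌋ then 1 else 0

  edgesWith-lookup : ∀ {m} t (s : Vec (Triple n) m) q →
    lookup (mults (edgesWith t s)) q ≡ Σℕ.ΣF m (λ i → hits t (pr q) (lookup s i))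
  edgesWith-lookup t s q = trans (VP.lookup-map q _ (pairs n)) (sum-map-ΣF (hits t (pr q)) s)

  hits-toggle-other : ∀ t p q x → q ≢ p → hits t (pr q) (toggle p x) ≡ hits t (pr q) x
  hits-toggle-other t p q (v , w , b) q≢p with represents (pr q) v w in eq
  ... | false = refl
  ... | true with represents (pr p) v w in ep
  ... | true = ⊥-elim (q≢p (trans (idx-uniq v w q eq) (sym (idx-uniq v w p ep))))
  ... | false with b
  ... | true = refl
  ... | false = refl

  hits-toggle-same : ∀ t p x → hits t (pr p) (toggle p x) ≡ hits (not t) (pr p) x
  hits-toggle-same t p (v , w , b) with represents (pr p) v w
  ... | false = refl
  ... | true with b | t
  ... | true | true = refl
  ... | true | false = refl
  ... | false | true = refl
  ... | false | false = refl

  markedOf-toggle : ∀ {m} p (s : Vec (Triple n) m) → markedOf (Vec.map (toggle p) s) ≡ swapMarks p (markedOf s)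
  markedOf-toggle {m} p s = cong₂ _,_ (cong ms (vec-ext _ _ (entry false))) (cong ms (vec-ext _ _ (entry true)))
    where
    entry : ∀ t q → lookup (mults (edgesWith t (Vec.map (toggle p) s))) q ≡
                 lookup (mults (edgesWith t s) [ p ]≔ lookup (mults (edgesWith (not t) s)) p) q
    entry t q with q Fin.≟ p
    ... | yes refl = begin
        lookup (mults (edgesWith t (Vec.map (toggle q) s))) q
      ≡⟨ edgesWith-lookup t (Vec.map (toggle q) s) q ⟩
        Σℕ.ΣF m (λ i → hits t (pr q) (lookup (Vec.map (toggle q) s) i))
      ≡⟨ Σℕ.ΣF-cong m (λ i → trans (cong (hits t (pr q)) (VP.lookup-map i (toggle q) s)) (hits-toggle-same t q (lookup s i))) ⟩
        Σℕ.ΣF m (λ i → hits (not t) (pr q) (lookup s i))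
      ≡⟨ sym (edgesWith-lookup (not t) s q) ⟩
        lookup (mults (edgesWith (not t) s)) q
      ≡⟨ sym (VP.lookup∘update q (mults (edgesWith t s)) (lookup (mults (edgesWith (not t) s)) q)) ⟩
        lookup (mults (edgesWith t s) [ q ]≔ lookup (mults (edgesWith (not t) s)) q) q
      ∎
      where open ≡-Reasoning
    ... | no q≢p = begin
        lookup (mults (edgesWith t (Vec.map (toggle p) s))) q
      ≡⟨ edgesWith-lookup t (Vec.map (toggle p) s) q ⟩
        Σℕ.ΣF m (λ i → hits t (pr q) (lookup (Vec.map (toggle p) s) i))
      ≡⟨ Σℕ.ΣF-cong m (λ i → trans (cong (hits t (pr q)) (VP.lookup-map i (toggle p) s)) (hits-toggle-other t p q (lookup s i) q≢p)) ⟩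
        Σℕ.ΣF m (λ i → hits t (pr q) (lookup s i))
      ≡⟨ sym (edgesWith-lookup t s q) ⟩
        lookup (mults (edgesWith t s)) q
      ≡⟨ sym (VP.lookup∘update′ q≢p (mults (edgesWith t s)) (lookup (mults (edgesWith (not t) s)) p)) ⟩
        lookup (mults (edgesWith t s) [ p ]≔ lookup (mults (edgesWith (not t) s)) p) q
      ∎
      where open ≡-Reasoning

  -- toggle p permutes the triples (it exchanges the two mark bits on p)
  triples-toggle-invariant : ∀ p (g : Triple n → ℤ) → Σℤ.ΣL (triples n) (g ∘ toggle p) ≡ Σℤ.ΣL (triples n) g
  triples-toggle-invariant p g = begin
      Σℤ.ΣL (triples n) (g ∘ toggle p)
    ≡⟨ Σℤ.ΣL-cart (allFin n) BB (g ∘ toggle p) ⟩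
      Σℤ.ΣL (allFin n) (λ v → Σℤ.ΣL BB (λ y → g (toggle p (v , y))))
    ≡⟨ Σℤ.ΣL-cong (allFin n) (λ v → trans (Σℤ.ΣL-cart (allFin n) (true ∷ false ∷ []) (λ y → g (toggle p (v , y)))) (Σℤ.ΣL-cong (allFin n) (λ w → bits-swapped v w))) ⟩
      Σℤ.ΣL (allFin n) (λ v → Σℤ.ΣL (allFin n) (λ w → Σℤ.ΣL (true ∷ false ∷ []) (λ b → g (v , w , b))))
    ≡⟨ Σℤ.ΣL-cong (allFin n) (λ v → sym (Σℤ.ΣL-cart (allFin n) (true ∷ false ∷ []) (λ y → g (v , y)))) ⟩
      Σℤ.ΣL (allFin n) (λ v → Σℤ.ΣL BB (λ y → g (v , y)))
    ≡⟨ sym (Σℤ.ΣL-cart (allFin n) BB g) ⟩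
      Σℤ.ΣL (triples n) g
    ∎
    where
    open ≡-Reasoning
    BB : List (Fin n × Bool)
    BB = List.cartesianProduct (allFin n) (true ∷ false ∷ [])
    bits-swapped : ∀ v w → Σℤ.ΣL (true ∷ false ∷ []) (λ b → g (toggle p (v , w , b))) ≡ Σℤ.ΣL (true ∷ false ∷ []) (λ b → g (v , w , b))
    bits-swapped v w with represents (pr p) v w
    ... | false = refl
    ... | true = trans (cong (ℤ._+_ (g (v , w , false))) (ZP.+-identityʳ (g (v , w , true))))
                  (trans (ZP.+-comm (g (v , w , false)) (g (v , w , true))) (cong (ℤ._+_ (g (v , w , true))) (sym (ZP.+-identityʳ (g (v , w , false))))))

  seqs-toggle-invariant : ∀ p m (F : Vec (Triple n) m → ℤ) →
    Σℤ.ΣL (seqs (triples n) m) (F ∘ Vec.map (toggle p)) ≡ Σℤ.ΣL (seqs (triples n) m) F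
  seqs-toggle-invariant p = seqs-map-invariant (triples n) (toggle p) (triples-toggle-invariant p)

decV : ∀ {k} → DecidableEquality (Vec ℕ k)
decV = VP.≡-dec ℕ._≟_

ΣL-applyUpTo : ∀ {A : Set} (g : ℕ → A) (N : ℕ) (f : A → ℕ) →
  ΣL (applyUpTo g N) f ≡ ΣF N (λ i → f (g (toℕ i)))
ΣL-applyUpTo g zero f = refl
ΣL-applyUpTo g (suc N) f = cong (f (g 0) +_) (ΣL-applyUpTo (g ∘ suc) N f)

ΣupTo-single : ∀ (N a0 : ℕ) (f : ℕ → ℕ) → (∀ a → a ≢ a0 → f a ≡ 0) →
  ΣL (upTo N) f ≡ (if a0 ℕ.<ᵇ N then f a0 else 0)
ΣupTo-single N a0 f z with a0 ℕ.<ᵇ N in eq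
... | true = trans (ΣL-applyUpTo (λ x → x) N f)
    (trans (Σℕ.ΣF-single N _ p (λ i i≢p → z (toℕ i) (λ e → i≢p (FP.toℕ-injective (trans e (sym (FP.toℕ-fromℕ< a0<N)))))))
           (cong f (FP.toℕ-fromℕ< a0<N)))
  where
  a0<N : a0 < N
  a0<N = NP.<ᵇ⇒< a0 N (subst T (sym eq) _)
  p : Fin N
  p = Fin.fromℕ< a0<N
... | false = trans (ΣL-applyUpTo (λ x → x) N f) (Σℕ.ΣF-zero N _ (λ i → z (toℕ i) (λ e → ne e)))
  where
  ne : ∀ {i : Fin N} → toℕ i ≢ a0
  ne {i} e = subst T eq (NP.<⇒<ᵇ (subst (_< N) e (FP.toℕ<n i)))

does-cons : ∀ {k} (a b : ℕ) (x y : Vec ℕ k) →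
  ⟦ does (decV (a ∷ x) (b ∷ y)) ⟧ ≡ (if does (a ℕ.≟ b) then ⟦ does (decV x y) ⟧ else 0)
does-cons a b x y = by-head (does (a ℕ.≟ b))
  where
  by-head : ∀ c → ⟦ c ∧ does (decV x y) ⟧ ≡ (if c then ⟦ does (decV x y) ⟧ else 0)
  by-head true = refl
  by-head false = refl

comps-once : ∀ k m (v : Vec ℕ k) → ΣL (comps k m) (λ y → ⟦ does (decV v y) ⟧) ≡ ⟦ Vec.sum v ≡ᵇ m ⟧
comps-once zero zero [] = refl
comps-once zero (suc m) [] = refl
comps-once (suc k) m (a0 ∷ v) = begin
    ΣL (comps (suc k) m) (λ y → ⟦ does (decV (a0 ∷ v) y) ⟧)
  ≡⟨ Σℕ.ΣL-concatMap (λ a → map (a ∷_) (comps k (m ∸ a))) (upTo (suc m)) _ ⟩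
    ΣL (upTo (suc m)) (λ a → ΣL (map (a ∷_) (comps k (m ∸ a))) (λ y → ⟦ does (decV (a0 ∷ v) y) ⟧))
  ≡⟨ Σℕ.ΣL-cong (upTo (suc m)) (λ a → trans (Σℕ.ΣL-map (a ∷_) (comps k (m ∸ a)) _) (inner a)) ⟩
    ΣL (upTo (suc m)) F
  ≡⟨ ΣupTo-single (suc m) a0 F off-a0 ⟩
    (if a0 ℕ.<ᵇ suc m then F a0 else 0)
  ≡⟨ at-a0 ⟩
    ⟦ a0 + Vec.sum v ≡ᵇ m ⟧
  ∎
  where
  open ≡-Reasoning
  F : ℕ → ℕ
  F a = if does (a0 ℕ.≟ a) then ⟦ Vec.sum v ≡ᵇ m ∸ a ⟧ else 0
  inner : ∀ a → ΣL (comps k (m ∸ a)) (λ y → ⟦ does (decV (a0 ∷ v) (a ∷ y)) ⟧) ≡ F a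
  inner a = by-head (a0 ℕ.≟ a)
    where
    R : Bool → ℕ
    R z = if z then ⟦ Vec.sum v ≡ᵇ m ∸ a ⟧ else 0
    by-head : Dec (a0 ≡ a) → ΣL (comps k (m ∸ a)) (λ y → ⟦ does (decV (a0 ∷ v) (a ∷ y)) ⟧) ≡ R (does (a0 ℕ.≟ a))
    by-head (yes e) = trans (Σℕ.ΣL-cong (comps k (m ∸ a)) (λ y → trans (does-cons a0 a v y) (cong (λ z → if z then ⟦ does (decV v y) ⟧ else 0) (dec-true (a0 ℕ.≟ a) e))))
                         (trans (comps-once k (m ∸ a) v) (sym (cong R (dec-true (a0 ℕ.≟ a) e))))
    by-head (no ne) = trans (Σℕ.ΣL-zero (comps k (m ∸ a)) _ (λ y → trans (does-cons a0 a v y) (cong (λ z → if z then ⟦ does (decV v y) ⟧ else 0) (dec-false (a0 ℕ.≟ a) ne))))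
                   (sym (cong R (dec-false (a0 ℕ.≟ a) ne)))
  off-a0 : ∀ a → a ≢ a0 → F a ≡ 0
  off-a0 a ne = cong (λ z → if z then ⟦ Vec.sum v ≡ᵇ m ∸ a ⟧ else 0) (dec-false (a0 ℕ.≟ a) (λ e → ne (sym e)))
  at-a0 : (if a0 ℕ.<ᵇ suc m then F a0 else 0) ≡ ⟦ a0 + Vec.sum v ≡ᵇ m ⟧
  at-a0 with a0 ℕ.<ᵇ suc m in eq
  ... | true = trans (cong (λ z → if z then ⟦ Vec.sum v ≡ᵇ m ∸ a0 ⟧ else 0) (dec-true (a0 ℕ.≟ a0) refl))
      (cong ⟦_⟧ (does-⇔ (mk⇔ (λ e → trans (cong (a0 +_) e) (NP.m+[n∸m]≡n a0≤m))
                                 (λ e → trans (sym (NP.m+n∸m≡n a0 (Vec.sum v))) (cong (_∸ a0) e)))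
                           (Vec.sum v ℕ.≟ m ∸ a0) (a0 + Vec.sum v ℕ.≟ m)))
    where
    a0≤m : a0 ≤ m
    a0≤m = NP.≤-pred (NP.<ᵇ⇒< a0 (suc m) (subst T (sym eq) _))
  ... | false = sym (cong ⟦_⟧ (≢⇒≡ᵇ _ _ (λ e → subst T eq (NP.<⇒<ᵇ (ℕ.s≤s (subst (a0 ≤_) e (NP.m≤m+n a0 (Vec.sum v))))))))

does-≟ᴹ : ∀ n (a b c d : Vec ℕ (P n)) →
  does (_≟ᴹ_ {n} (ms a , ms b) (ms c , ms d)) ≡ does (decV a c) ∧ does (decV b d)
does-≟ᴹ n a b c d = by-components (decV a c) (decV b d)
  where
  by-components : Dec (a ≡ c) → Dec (b ≡ d) → does (_≟ᴹ_ {n} (ms a , ms b) (ms c , ms d)) ≡ does (decV a c) ∧ does (decV b d)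
  by-components (yes e1) (yes e2) = trans (dec-true (_≟ᴹ_ {n} (ms a , ms b) (ms c , ms d)) (cong₂ (λ x y → ms x , ms y) e1 e2))
    (sym (cong₂ _∧_ (dec-true (decV a c) e1) (dec-true (decV b d) e2)))
  by-components (yes e1) (no n2) = trans (dec-false (_≟ᴹ_ {n} (ms a , ms b) (ms c , ms d)) (λ e → n2 (cong (mults ∘ proj₂) e)))
    (sym (cong₂ _∧_ (dec-true (decV a c) e1) (dec-false (decV b d) n2)))
  by-components (no n1) _ = trans (dec-false (_≟ᴹ_ {n} (ms a , ms b) (ms c , ms d)) (λ e → n1 (cong (mults ∘ proj₁) e)))
    (sym (cong (_∧ does (decV b d)) (dec-false (decV a c) n1)))

product-once : ∀ {n} a b (E Ē : Mults n) →
  ΣL (cartesianProduct (multisets n a) (multisets n b)) (λ H → ⟦ does ((ms {n} E , ms {n} Ē) ≟ᴹ H) ⟧) ≡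
  ⟦ Vec.sum E ≡ᵇ a ⟧ * ⟦ Vec.sum Ē ≡ᵇ b ⟧
product-once {n} a b E Ē = begin
    ΣL (cartesianProduct (multisets n a) (multisets n b)) (λ H → ⟦ does ((ms {n} E , ms {n} Ē) ≟ᴹ H) ⟧)
  ≡⟨ Σℕ.ΣL-cart (multisets n a) (multisets n b) _ ⟩
    ΣL (multisets n a) (λ A → ΣL (multisets n b) (λ B → ⟦ does ((ms {n} E , ms {n} Ē) ≟ᴹ (A , B)) ⟧))
  ≡⟨ Σℕ.ΣL-map (ms {n}) (comps (P n) a) _ ⟩
    ΣL (comps (P n) a) (λ x → ΣL (multisets n b) (λ B → ⟦ does ((ms {n} E , ms {n} Ē) ≟ᴹ (ms {n} x , B)) ⟧))
  ≡⟨ Σℕ.ΣL-cong (comps (P n) a) (λ x → trans (Σℕ.ΣL-map (ms {n}) (comps (P n) b) _) (factor x)) ⟩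
    ΣL (comps (P n) a) (λ x → ⟦ Vec.sum Ē ≡ᵇ b ⟧ * ⟦ does (decV E x) ⟧)
  ≡⟨ Σℕ.ΣL-scal (comps (P n) a) ⟦ Vec.sum Ē ≡ᵇ b ⟧ _ ⟩
    ⟦ Vec.sum Ē ≡ᵇ b ⟧ * ΣL (comps (P n) a) (λ x → ⟦ does (decV E x) ⟧)
  ≡⟨ cong (⟦ Vec.sum Ē ≡ᵇ b ⟧ *_) (comps-once (P n) a E) ⟩
    ⟦ Vec.sum Ē ≡ᵇ b ⟧ * ⟦ Vec.sum E ≡ᵇ a ⟧
  ≡⟨ NP.*-comm ⟦ Vec.sum Ē ≡ᵇ b ⟧ ⟦ Vec.sum E ≡ᵇ a ⟧ ⟩
    ⟦ Vec.sum E ≡ᵇ a ⟧ * ⟦ Vec.sum Ē ≡ᵇ b ⟧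
  ∎
  where
  open ≡-Reasoning
  factor : ∀ x → ΣL (comps (P n) b) (λ y → ⟦ does ((ms {n} E , ms {n} Ē) ≟ᴹ (ms {n} x , ms {n} y)) ⟧) ≡ ⟦ Vec.sum Ē ≡ᵇ b ⟧ * ⟦ does (decV E x) ⟧
  factor x = begin
      ΣL (comps (P n) b) (λ y → ⟦ does ((ms {n} E , ms {n} Ē) ≟ᴹ (ms {n} x , ms {n} y)) ⟧)
    ≡⟨ Σℕ.ΣL-cong (comps (P n) b) (λ y → trans (cong ⟦_⟧ (does-≟ᴹ n E Ē x y)) (⟦∧⟧ (does (decV E x)) (does (decV Ē y)))) ⟩
      ΣL (comps (P n) b) (λ y → ⟦ does (decV E x) ⟧ * ⟦ does (decV Ē y) ⟧)
    ≡⟨ Σℕ.ΣL-scal (comps (P n) b) ⟦ does (decV E x) ⟧ _ ⟩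
      ⟦ does (decV E x) ⟧ * ΣL (comps (P n) b) (λ y → ⟦ does (decV Ē y) ⟧)
    ≡⟨ cong (⟦ does (decV E x) ⟧ *_) (comps-once (P n) b Ē) ⟩
      ⟦ does (decV E x) ⟧ * ⟦ Vec.sum Ē ≡ᵇ b ⟧
    ≡⟨ NP.*-comm ⟦ does (decV E x) ⟧ _ ⟩
      ⟦ Vec.sum Ē ≡ᵇ b ⟧ * ⟦ does (decV E x) ⟧
    ∎

markedAll-once : ∀ {n} m (E Ē : Mults n) → Vec.sum E + Vec.sum Ē ≡ m →
  occurrences _≟ᴹ_ (ms {n} E , ms {n} Ē) (markedAll n m) ≡ 1
markedAll-once {n} m E Ē sz = begin
    ΣL (markedAll n m) (λ H → ⟦ does ((ms {n} E , ms {n} Ē) ≟ᴹ H) ⟧)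
  ≡⟨ Σℕ.ΣL-concatMap (λ j → List.cartesianProduct (multisets n (m ∸ j)) (multisets n j)) (upTo (suc m)) (λ H → ⟦ does ((ms {n} E , ms {n} Ē) ≟ᴹ H) ⟧) ⟩
    ΣL (upTo (suc m)) (λ j → ΣL (List.cartesianProduct (multisets n (m ∸ j)) (multisets n j)) (λ H → ⟦ does ((ms {n} E , ms {n} Ē) ≟ᴹ H) ⟧))
  ≡⟨ Σℕ.ΣL-cong (upTo (suc m)) (λ j → product-once {n} (m ∸ j) j E Ē) ⟩
    ΣL (upTo (suc m)) F
  ≡⟨ ΣupTo-single (suc m) (Vec.sum Ē) F off-size ⟩
    (if Vec.sum Ē ℕ.<ᵇ suc m then F (Vec.sum Ē) else 0)
  ≡⟨ at-size ⟩
    1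
  ∎
  where
  open ≡-Reasoning
  F : ℕ → ℕ
  F j = ⟦ Vec.sum E ≡ᵇ m ∸ j ⟧ * ⟦ Vec.sum Ē ≡ᵇ j ⟧
  off-size : ∀ j → j ≢ Vec.sum Ē → F j ≡ 0
  off-size j ne = trans (cong (λ z → ⟦ Vec.sum E ≡ᵇ m ∸ j ⟧ * ⟦ z ⟧) (≢⇒≡ᵇ (Vec.sum Ē) j (λ e → ne (sym e)))) (NP.*-zeroʳ ⟦ Vec.sum E ≡ᵇ m ∸ j ⟧)
  at-size : (if Vec.sum Ē ℕ.<ᵇ suc m then F (Vec.sum Ē) else 0) ≡ 1
  at-size with Vec.sum Ē ℕ.<ᵇ suc m in eq
  ... | true = cong₂ (λ x y → ⟦ x ⟧ * ⟦ y ⟧)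
           (≡⇒≡ᵇ _ _ (trans (sym (NP.m+n∸n≡m (Vec.sum E) (Vec.sum Ē))) (cong (_∸ Vec.sum Ē) sz)))
           (≡⇒≡ᵇ (Vec.sum Ē) (Vec.sum Ē) refl)
  ... | false = ⊥-elim (subst T eq (NP.<⇒<ᵇ (ℕ.s≤s (subst (Vec.sum Ē ≤_) sz (NP.m≤n+m (Vec.sum Ē) (Vec.sum E))))))

zeros : ∀ {k} → Vec ℕ k
zeros = Vec.replicate _ 0

unmarkedAll : (n m : ℕ) → List (Marked n)
unmarkedAll n m = map (λ A → A , ms {n} (zeros {P n})) (multisets n m)

unmarkedAll-once : ∀ {n} m (E : Mults n) → Vec.sum E ≡ m → occurrences _≟ᴹ_ (ms {n} E , ms {n} zeros) (unmarkedAll n m) ≡ 1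
unmarkedAll-once {n} m E sz = begin
    ΣL (unmarkedAll n m) (λ H → ⟦ does ((ms {n} E , ms {n} zeros) ≟ᴹ H) ⟧)
  ≡⟨ Σℕ.ΣL-map (λ A → A , ms {n} (zeros {P n})) (multisets n m) (λ H → ⟦ does ((ms {n} E , ms {n} zeros) ≟ᴹ H) ⟧) ⟩
    ΣL (multisets n m) (λ A → ⟦ does ((ms {n} E , ms {n} zeros) ≟ᴹ (A , ms {n} zeros)) ⟧)
  ≡⟨ Σℕ.ΣL-map (ms {n}) (comps (P n) m) (λ A → ⟦ does ((ms {n} E , ms {n} zeros) ≟ᴹ (A , ms {n} zeros)) ⟧) ⟩
    ΣL (comps (P n) m) (λ a → ⟦ does ((ms {n} E , ms {n} zeros) ≟ᴹ (ms {n} a , ms {n} zeros)) ⟧)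
  ≡⟨ Σℕ.ΣL-cong (comps (P n) m) (λ a → cong ⟦_⟧ (trans (does-≟ᴹ n E zeros a zeros)
       (trans (cong (does (decV E a) ∧_) (dec-true (decV (zeros {P n}) zeros) refl)) (BP.∧-identityʳ (does (decV E a)))))) ⟩
    ΣL (comps (P n) m) (λ a → ⟦ does (decV E a) ⟧)
  ≡⟨ comps-once (P n) m E ⟩
    ⟦ Vec.sum E ≡ᵇ m ⟧
  ≡⟨ cong ⟦_⟧ (≡⇒≡ᵇ _ _ sz) ⟩
    1
  ∎
  where open ≡-Reasoning

0≢1 : 0 ≢ 1
0≢1 ()

0≢2 : 0 ≢ 2
0≢2 ()

1≢2 : 1 ≢ 2
1≢2 ()

1≰0 : ¬ (1 ≤ 0)
1≰0 ()

2≤1 : ∀ {b : ℕ} → 2 ≤ b → b ≤ 1 → ⊥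
2≤1 (ℕ.s≤s (ℕ.s≤s _)) (ℕ.s≤s ())

3≤2 : ∀ {b : ℕ} → 3 ≤ b → b ≡ 2 → ⊥
3≤2 (ℕ.s≤s (ℕ.s≤s (ℕ.s≤s _))) ()

pos⇒nz : ∀ {a b : ℕ} → 1 ≤ a → a ≤ b → b ≢ 0
pos⇒nz (ℕ.s≤s _) (ℕ.s≤s _) ()

≤1≢1 : ∀ {x} → x ≤ 1 → x ≢ 1 → x ≡ 0
≤1≢1 {0} _ _ = refl
≤1≢1 {1} _ ne = ⊥-elim (ne refl)
≤1≢1 {suc (suc x)} (ℕ.s≤s ()) _

≤2≢2 : ∀ {x} → x ≤ 2 → x ≢ 2 → x ≤ 1
≤2≢2 {0} _ _ = ℕ.z≤n
≤2≢2 {1} _ _ = ℕ.s≤s ℕ.z≤n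
≤2≢2 {2} _ ne = ⊥-elim (ne refl)
≤2≢2 {suc (suc (suc x))} (ℕ.s≤s (ℕ.s≤s ())) _

plus0≡2 : ∀ d' → d' + 0 ≡ 2 → d' ≡ 2
plus0≡2 d' h = trans (sym (NP.+-identityʳ d')) h

plus2≡2 : ∀ d' → d' + 2 ≡ 2 → d' ≡ 0
plus2≡2 d' h = NP.+-cancelʳ-≡ 2 d' 0 h

split-1 : ∀ e e' → e + e' ≡ 1 → (e ≡ 0 × e' ≡ 1) ⊎ (e ≡ 1 × e' ≡ 0)
split-1 zero e' h = inj₁ (refl , h)
split-1 (suc zero) e' h = inj₂ (refl , NP.suc-injective h)
split-1 (suc (suc e)) e' ()

split-2 : ∀ e e' → e + e' ≡ 2 → (e ≡ 0 × e' ≡ 2) ⊎ (e ≡ 1 × e' ≡ 1) ⊎ (e ≡ 2 × e' ≡ 0)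
split-2 zero e' h = inj₁ (refl , h)
split-2 (suc zero) e' h = inj₂ (inj₁ (refl , NP.suc-injective h))
split-2 (suc (suc zero)) e' h = inj₂ (inj₂ (refl , NP.suc-injective (NP.suc-injective h)))
split-2 (suc (suc (suc e))) e' ()

subst-update : ∀ {d' d e e' o E0 E1 O D : ℕ} → d' + e * o ≡ d + e' * o → e ≡ E0 → e' ≡ E1 → o ≡ O → d ≡ D → d' + E0 * O ≡ D + E1 * O
subst-update h refl refl refl refl = h

subst-≤₁ : ∀ {a b D A B : ℕ} → a * b ≤ D → a ≡ A → b ≡ B → A * B ≤ D
subst-≤₁ h refl refl = h

subst-≤₂ : ∀ {a b c d D A B C Dd : ℕ} → a * b + c * d ≤ D → a ≡ A → b ≡ B → c ≡ C → d ≡ Dd → A * B + C * Dd ≤ D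
subst-≤₂ h refl refl refl refl = h

offset-by-one : ∀ {a b x y : ℕ} → a + x ≡ b + y → (x ≡ 0 × y ≡ 1) ⊎ (x ≡ 1 × y ≡ 0) → a ≡ suc b ⊎ suc a ≡ b
offset-by-one {a} {b} h (inj₁ (refl , refl)) = inj₁ (trans (sym (NP.+-identityʳ a)) (trans h (NP.+-comm b 1)))
offset-by-one {a} {b} h (inj₂ (refl , refl)) = inj₂ (trans (NP.+-comm 1 a) (trans h (NP.+-identityʳ b)))

sign : ℕ → ℤ
sign zero = ℤ.+ 1
sign (suc k) = ℤ.- sign k
sign-flip : ∀ a b → (a ≡ suc b ⊎ suc a ≡ b) → sign a ≡ ℤ.- sign b
sign-flip a b (inj₁ refl) = refl
sign-flip a b (inj₂ refl) = sym (ZP.neg-involutive (sign a))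

module MultiplicityFacts {n : ℕ} where
  -- the representative pair at an index (fixes the implicit vertex count)
  pair : Fin (P n) → Fin n × Fin n
  pair = pr {n}

  multAt : Mults n → Fin n → Fin n → ℕ
  multAt E v w = lookup E (idx v w)

  multAt-sym : ∀ (E : Mults n) v w → multAt E v w ≡ multAt E w v
  multAt-sym E v w = cong (lookup E) (idx-sym v w)

  upd-self : ∀ (Ē : Mults n) q c → lookup (Ē [ q ]≔ c) q ≡ c
  upd-self Ē q c = VP.lookup∘update q Ē c

  upd-other : ∀ (Ē : Mults n) q r c → r ≢ q → lookup (Ē [ q ]≔ c) r ≡ lookup Ē r
  upd-other Ē q r c ne = VP.lookup∘update′ ne Ē c

  unionV : Mults n → Mults n → Mults n
  unionV E Ē = Vec.zipWith _+_ E Ē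

  unionV-lookup : ∀ (E Ē : Mults n) q → lookup (unionV E Ē) q ≡ lookup E q + lookup Ē q
  unionV-lookup E Ē q = VP.lookup-zipWith _+_ q E Ē

  marked≤union : ∀ (E Ē : Mults n) q → lookup Ē q ≤ lookup (unionV E Ē) q
  marked≤union E Ē q = subst (lookup Ē q ≤_) (sym (unionV-lookup E Ē q)) (NP.m≤n+m _ _)

  sum-union : ∀ (E Ē : Mults n) → Vec.sum (unionV E Ē) ≡ Vec.sum E + Vec.sum Ē
  sum-union E Ē = trans (sum-ΣF (unionV E Ē)) (trans (Σℕ.ΣF-cong (P n) (unionV-lookup E Ē))
                    (trans (Σℕ.ΣF-⊕ (P n) (lookup E) (lookup Ē)) (sym (cong₂ _+_ (sum-ΣF E) (sum-ΣF Ē)))))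

  union-zeros : ∀ (E : Mults n) → unionV E zeros ≡ E
  union-zeros E = vec-ext _ _ (λ r → trans (unionV-lookup E zeros r) (trans (cong (lookup E r +_) (VP.lookup-replicate r 0)) (NP.+-identityʳ _)))

  union-swapMarks : ∀ (E Ē : Mults n) q → unionV (E [ q ]≔ lookup Ē q) (Ē [ q ]≔ lookup E q) ≡ unionV E Ē
  union-swapMarks E Ē q = vec-ext _ _ entry
    where
    entry : ∀ r → lookup (unionV (E [ q ]≔ lookup Ē q) (Ē [ q ]≔ lookup E q)) r ≡ lookup (unionV E Ē) r
    entry r with r Fin.≟ q
    ... | yes refl = trans (unionV-lookup (E [ r ]≔ lookup Ē r) (Ē [ r ]≔ lookup E r) r) (trans (cong₂ _+_ (upd-self E r (lookup Ē r)) (upd-self Ē r (lookup E r))) (trans (NP.+-comm (lookup Ē r) (lookup E r)) (sym (unionV-lookup E Ē r))))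
    ... | no ne = trans (unionV-lookup (E [ q ]≔ lookup Ē q) (Ē [ q ]≔ lookup E q) r) (trans (cong₂ _+_ (upd-other E q r (lookup Ē q) ne) (upd-other Ē q r (lookup E q) ne)) (sym (unionV-lookup E Ē r)))

  swapMarks-involutive : ∀ (E Ē : Mults n) q → (Ē [ q ]≔ lookup E q) [ q ]≔ lookup (E [ q ]≔ lookup Ē q) q ≡ Ē
  swapMarks-involutive E Ē q = vec-ext _ _ entry
    where
    entry : ∀ r → lookup ((Ē [ q ]≔ lookup E q) [ q ]≔ lookup (E [ q ]≔ lookup Ē q) q) r ≡ lookup Ē r
    entry r with r Fin.≟ q
    ... | yes refl = trans (upd-self (Ē [ r ]≔ lookup E r) r (lookup (E [ r ]≔ lookup Ē r) r)) (upd-self E r (lookup Ē r))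
    ... | no ne = trans (upd-other (Ē [ q ]≔ lookup E q) q r (lookup (E [ q ]≔ lookup Ē q) q) ne) (upd-other Ē q r (lookup E q) ne)

  deg-ΣF : ∀ (E : Mults n) v → deg (ms E) v ≡ ΣF (P n) (λ q → lookup E q * occ v (pair q))
  deg-ΣF E v = sum-zipWith-ΣF (λ p k → k * occ v p) (pairs n) E

  occ-idx : ∀ x a b → occ x (pair (idx a b)) ≡ ⟦ a =ᶠ x ⟧ + ⟦ b =ᶠ x ⟧
  occ-idx x a b with pr-idx a b
  ... | inj₁ eq = cong (occ x) eq
  ... | inj₂ eq = trans (cong (occ x) eq) (NP.+-comm ⟦ b =ᶠ x ⟧ ⟦ a =ᶠ x ⟧)

  occ-loop : ∀ a → occ a (pair (idx a a)) ≡ 2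
  occ-loop a rewrite occ-idx a a a | =ᶠ-refl a = refl

  occ-nl : ∀ a b → a ≢ b → occ a (pair (idx a b)) ≡ 1
  occ-nl a b ne rewrite occ-idx a a b | =ᶠ-refl a | ≢⇒=ᶠ {i = b} {a} (λ e → ne (sym e)) = refl

  occ-none : ∀ x a b → a ≢ x → b ≢ x → occ x (pair (idx a b)) ≡ 0
  occ-none x a b na not-both rewrite occ-idx x a b | ≢⇒=ᶠ na | ≢⇒=ᶠ not-both = refl

  occ-pos : ∀ a b → 1 ≤ occ a (pair (idx a b))
  occ-pos a b = subst (1 ≤_) (sym (occ-idx a a b)) (subst (λ z → 1 ≤ ⟦ z ⟧ + ⟦ b =ᶠ a ⟧) (sym (=ᶠ-refl a)) (ℕ.s≤s ℕ.z≤n))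

  deg-ge1 : ∀ (E : Mults n) v q → lookup E q * occ v (pair q) ≤ deg (ms E) v
  deg-ge1 E v q = subst (lookup E q * occ v (pair q) ≤_) (sym (deg-ΣF E v)) (ΣF-ge1 (P n) (λ q → lookup E q * occ v (pair q)) q)

  deg-ge2 : ∀ (E : Mults n) v p q → q ≢ p → lookup E p * occ v (pair p) + lookup E q * occ v (pair q) ≤ deg (ms E) v
  deg-ge2 E v p q ne = subst (lookup E p * occ v (pair p) + lookup E q * occ v (pair q) ≤_) (sym (deg-ΣF E v)) (ΣF-ge2 (P n) (λ q → lookup E q * occ v (pair q)) p q ne)

  deg-upd : ∀ (E : Mults n) v p a → deg (ms (E [ p ]≔ a)) v + lookup E p * occ v (pair p) ≡ deg (ms E) v + a * occ v (pair p)
  deg-upd E v p a = begin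
      deg (ms (E [ p ]≔ a)) v + lookup E p * occ v (pair p)
    ≡⟨ cong (_+ lookup E p * occ v (pair p)) (deg-ΣF (E [ p ]≔ a) v) ⟩
      ΣF (P n) (λ q → lookup (E [ p ]≔ a) q * occ v (pair q)) + lookup E p * occ v (pair p)
    ≡⟨ ΣF-update (P n) (λ q → lookup (E [ p ]≔ a) q * occ v (pair q)) (λ q → lookup E q * occ v (pair q)) p (λ q ne → cong (_* occ v (pair q)) (VP.lookup∘update′ ne E a)) ⟩
      ΣF (P n) (λ q → lookup E q * occ v (pair q)) + lookup (E [ p ]≔ a) p * occ v (pair p)
    ≡⟨ cong₂ _+_ (sym (deg-ΣF E v)) (cong (_* occ v (pair p)) (VP.lookup∘update p E a)) ⟩
      deg (ms E) v + a * occ v (pair p)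
    ∎
    where open ≡-Reasoning

  deg-zeros : ∀ v → deg (ms (zeros {P n})) v ≡ 0
  deg-zeros v = trans (deg-ΣF zeros v) (Σℕ.ΣF-zero (P n) _ (λ q → cong (_* occ v (pair q)) (VP.lookup-replicate q 0)))

  isLoop-idx : ∀ a b → isLoop (pair (idx a b)) ≡ (a =ᶠ b)
  isLoop-idx a b with pr-idx a b
  ... | inj₁ eq = cong isLoop eq
  ... | inj₂ eq = trans (cong isLoop eq) (=ᶠ-sym b a)

  idx-xx≢ : ∀ (x y : Fin n) → x ≢ y → idx x x ≢ idx x y
  idx-xx≢ x y ne e with idx-inj x x x y e
  ... | inj₁ (_ , b) = ne b
  ... | inj₂ (a , _) = ne a

  vertexOK : Mults n → Fin n → Bool
  vertexOK Ē v = (deg (ms Ē) v ≡ᵇ 0) ∨ ((mult (ms Ē) v v ≡ᵇ 1) ∧ (deg (ms Ē) v ≡ᵇ 2)) ∨ anyV n (λ w → not (v =ᶠ w) ∧ (mult (ms Ē) v w ≡ᵇ 2) ∧ (deg (ms Ē) v ≡ᵇ 2))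

  VertexCase : Mults n → Fin n → Set
  VertexCase Ē v = deg (ms Ē) v ≡ 0 ⊎ (multAt Ē v v ≡ 1 × deg (ms Ē) v ≡ 2) ⊎ Σ (Fin n) (λ w → v ≢ w × multAt Ē v w ≡ 2 × deg (ms Ē) v ≡ 2)

  decode-vertex : ∀ (Ē : Mults n) v → vertexOK Ē v ≡ true → VertexCase Ē v
  decode-vertex Ē v e with ∨-true {deg (ms Ē) v ≡ᵇ 0} e
  ... | inj₁ x = inj₁ (≡ᵇ⇒≡ x)
  ... | inj₂ y with ∨-true {(mult (ms Ē) v v ≡ᵇ 1) ∧ (deg (ms Ē) v ≡ᵇ 2)} y
  ... | inj₁ x = let (a , b) = ∧-true {mult (ms Ē) v v ≡ᵇ 1} x in inj₂ (inj₁ (trans (sym (mult-lookup Ē v v)) (≡ᵇ⇒≡ a) , ≡ᵇ⇒≡ b))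
  ... | inj₂ x with anyV-elim {f = λ w → not (v =ᶠ w) ∧ (mult (ms Ē) v w ≡ᵇ 2) ∧ (deg (ms Ē) v ≡ᵇ 2)} x
  ... | w , ew = let (a , bc) = ∧-true {not (v =ᶠ w)} ew
                     (b , c) = ∧-true {mult (ms Ē) v w ≡ᵇ 2} bc
                 in inj₂ (inj₂ (w , (λ vw → t≢f (trans (sym a) (cong not (=ᶠ-refl' vw)))) , trans (sym (mult-lookup Ē v w)) (≡ᵇ⇒≡ b) , ≡ᵇ⇒≡ c))
    where
    =ᶠ-refl' : v ≡ w → (v =ᶠ w) ≡ true
    =ᶠ-refl' refl = =ᶠ-refl v

  encode-vertex : ∀ (Ē : Mults n) v → VertexCase Ē v → vertexOK Ē v ≡ true
  encode-vertex Ē v (inj₁ x) = ∨-introˡ _ (≡⇒≡ᵇ _ _ x)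
  encode-vertex Ē v (inj₂ (inj₁ (a , b))) = ∨-introʳ (deg (ms Ē) v ≡ᵇ 0) (∨-introˡ _ (∧-intro (≡⇒≡ᵇ _ _ (trans (mult-lookup Ē v v) a)) (≡⇒≡ᵇ _ _ b)))
  encode-vertex Ē v (inj₂ (inj₂ (w , ne , a , b))) = ∨-introʳ (deg (ms Ē) v ≡ᵇ 0) (∨-introʳ ((mult (ms Ē) v v ≡ᵇ 1) ∧ (deg (ms Ē) v ≡ᵇ 2))
    (anyV-intro {f = λ w → not (v =ᶠ w) ∧ (mult (ms Ē) v w ≡ᵇ 2) ∧ (deg (ms Ē) v ≡ᵇ 2)} w
      (∧-intro (cong not (≢⇒=ᶠ ne)) (∧-intro (≡⇒≡ᵇ _ _ (trans (mult-lookup Ē v w) a)) (≡⇒≡ᵇ _ _ b)))))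

  vertexOK-cong : ∀ (A B : Mults n) x → deg (ms A) x ≡ deg (ms B) x → (∀ w → mult (ms A) x w ≡ mult (ms B) x w) → vertexOK A x ≡ vertexOK B x
  vertexOK-cong A B x d same-mult = cong₂ _∨_ (cong (_≡ᵇ 0) d) (cong₂ _∨_ (cong₂ _∧_ (cong (_≡ᵇ 1) (same-mult x)) (cong (_≡ᵇ 2) d))
    (anyV-cong (λ w → cong₂ (λ z y → not (x =ᶠ w) ∧ (z ≡ᵇ 2) ∧ (y ≡ᵇ 2)) (same-mult w) d)))

  nonzero-deg⇒2 : ∀ (Ē : Mults n) x → VertexCase Ē x → deg (ms Ē) x ≢ 0 → deg (ms Ē) x ≡ 2
  nonzero-deg⇒2 Ē x (inj₁ d) nz = ⊥-elim (nz d)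
  nonzero-deg⇒2 Ē x (inj₂ (inj₁ (_ , d))) nz = d
  nonzero-deg⇒2 Ē x (inj₂ (inj₂ (_ , _ , _ , d))) nz = d

  no-single-marked-edge : ∀ (Ē : Mults n) x y → x ≢ y → lookup Ē (idx x y) ≡ 1 → VertexCase Ē x → ⊥
  no-single-marked-edge Ē x y ne e1 mcv = contra mcv
    where
    q = idx x y
    deg≥1 : 1 ≤ deg (ms Ē) x
    deg≥1 = subst-≤₁ (deg-ge1 Ē x q) e1 (occ-nl x y ne)
    d2 : deg (ms Ē) x ≡ 2
    d2 = nonzero-deg⇒2 Ē x mcv (pos⇒nz (ℕ.s≤s ℕ.z≤n) deg≥1)
    contra : VertexCase Ē x → ⊥
    contra (inj₁ d) = 1≰0 (subst (1 ≤_) d deg≥1)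
    contra (inj₂ (inj₁ (l1 , _))) = 3≤2 (subst-≤₂ (deg-ge2 Ē x q (idx x x) (idx-xx≢ x y ne)) e1 (occ-nl x y ne) l1 (occ-loop x)) d2
    contra (inj₂ (inj₂ (w , xw , l2 , _))) with idx x w Fin.≟ q
    ... | yes eq = 1≢2 (trans (sym e1) (trans (cong (lookup Ē) (sym eq)) l2))
    ... | no neq = 3≤2 (subst-≤₂ (deg-ge2 Ē x q (idx x w) neq) e1 (occ-nl x y ne) l2 (occ-nl x w xw)) d2

  swap-elsewhere : ∀ (Ē : Mults n) a b c x → a ≢ x → b ≢ x → vertexOK (Ē [ idx a b ]≔ c) x ≡ vertexOK Ē x
  swap-elsewhere Ē a b c x ax bx = vertexOK-cong (Ē [ idx a b ]≔ c) Ē x same-deg same-mult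
    where
    x∉ab : occ x (pair (idx a b)) ≡ 0
    x∉ab = occ-none x a b ax bx
    same-deg : deg (ms (Ē [ idx a b ]≔ c)) x ≡ deg (ms Ē) x
    same-deg = NP.+-cancelʳ-≡ 0 _ _ (trans (cong (_+_ (deg (ms (Ē [ idx a b ]≔ c)) x)) (sym (trans (cong (lookup Ē (idx a b) *_) x∉ab) (NP.*-zeroʳ (lookup Ē (idx a b))))))
           (trans (deg-upd Ē x (idx a b) c) (cong (_+_ (deg (ms Ē) x)) (trans (cong (c *_) x∉ab) (NP.*-zeroʳ c)))))
    same-mult : ∀ w → mult (ms (Ē [ idx a b ]≔ c)) x w ≡ mult (ms Ē) x w
    same-mult w = trans (mult-lookup _ x w) (trans (upd-other Ē (idx a b) (idx x w) c ne) (sym (mult-lookup Ē x w)))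
      where
      ne : idx x w ≢ idx a b
      ne e with idx-inj x w a b e
      ... | inj₁ (xa , _) = ax (sym xa)
      ... | inj₂ (xb , _) = bx (sym xb)

  swappable : Mults n → Fin (P n) → Bool
  swappable U q = (isLoop (pair q) ∧ (lookup U q ≡ᵇ 1)) ∨ (not (isLoop (pair q)) ∧ (lookup U q ≡ᵇ 2))

  decode-swappable : ∀ (U : Mults n) a b → swappable U (idx a b) ≡ true → (a ≡ b × multAt U a a ≡ 1) ⊎ (a ≢ b × multAt U a b ≡ 2)
  decode-swappable U a b e with ∨-true {isLoop (pair (idx a b)) ∧ (lookup U (idx a b) ≡ᵇ 1)} e
  ... | inj₁ x = let (l , u) = ∧-true {isLoop (pair (idx a b))} x
                     ab = =ᶠ⇒≡ (trans (sym (isLoop-idx a b)) l)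
                 in inj₁ (ab , subst (λ z → multAt U a z ≡ 1) (sym ab) (≡ᵇ⇒≡ u))
  ... | inj₂ x = let (l , u) = ∧-true {not (isLoop (pair (idx a b)))} x
                 in inj₂ (=ᶠ-false⇒≢ (trans (sym (isLoop-idx a b)) (notT l)) , ≡ᵇ⇒≡ u)
    where
    notT : ∀ {z} → not z ≡ true → z ≡ false
    notT {false} _ = refl

  swappable-loop : ∀ (U : Mults n) q → isLoop (pair q) ≡ true → swappable U q ≡ (lookup U q ≡ᵇ 1)
  swappable-loop U q e rewrite e = BP.∨-identityʳ _

  swappable-edge : ∀ (U : Mults n) q → isLoop (pair q) ≡ false → swappable U q ≡ (lookup U q ≡ᵇ 2)
  swappable-edge U q e rewrite e = refl

  -- The exponent k(G) + ℓ(G) is a sum over pairs: a marked loop contributes its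
  -- multiplicity, a marked non-loop edge contributes one if present.

  expTerm : Fin n × Fin n → ℕ → ℕ
  expTerm pp k = (if isLoop pp ∨ (k ≡ᵇ 0) then 0 else 1) + (if isLoop pp then k else 0)

  markExp : Marked n → ℕ
  markExp G = kk G + ℓ G

  expTerm-loop : ∀ pp k → isLoop pp ≡ true → expTerm pp k ≡ k
  expTerm-loop pp k e rewrite e = refl

  expTerm-edge : ∀ pp k → isLoop pp ≡ false → expTerm pp k ≡ (if k ≡ᵇ 0 then 0 else 1)
  expTerm-edge pp k e rewrite e = NP.+-identityʳ _

  markExp-ΣF : ∀ (E Ē : Mults n) → markExp (ms E , ms Ē) ≡ ΣF (P n) (λ q → expTerm (pair q) (lookup Ē q))
  markExp-ΣF E Ē = trans (cong₂ _+_ (sum-zipWith-ΣF _ (pairs n) Ē) (sum-zipWith-ΣF _ (pairs n) Ē))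
                   (sym (Σℕ.ΣF-⊕ (P n) _ _))

  markExp-swap : ∀ (E Ē : Mults n) q → markExp (swapMarks q (ms E , ms Ē)) + expTerm (pair q) (lookup Ē q) ≡ markExp (ms E , ms Ē) + expTerm (pair q) (lookup E q)
  markExp-swap E Ē q = begin
      markExp (swapMarks q (ms E , ms Ē)) + expTerm (pair q) (lookup Ē q)
    ≡⟨ cong (_+ expTerm (pair q) (lookup Ē q)) (markExp-ΣF (E [ q ]≔ lookup Ē q) (Ē [ q ]≔ lookup E q)) ⟩
      ΣF (P n) (λ r → expTerm (pair r) (lookup (Ē [ q ]≔ lookup E q) r)) + expTerm (pair q) (lookup Ē q)
    ≡⟨ ΣF-update (P n) (λ r → expTerm (pair r) (lookup (Ē [ q ]≔ lookup E q) r)) (λ r → expTerm (pair r) (lookup Ē r)) q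
         (λ r ne → cong (expTerm (pair r)) (upd-other Ē q r _ ne)) ⟩
      ΣF (P n) (λ r → expTerm (pair r) (lookup Ē r)) + expTerm (pair q) (lookup (Ē [ q ]≔ lookup E q) q)
    ≡⟨ cong₂ _+_ (sym (markExp-ΣF E Ē)) (cong (expTerm (pair q)) (upd-self Ē q _)) ⟩
      markExp (ms E , ms Ē) + expTerm (pair q) (lookup E q)
    ∎
    where open ≡-Reasoning

  expTerm-0 : ∀ pp → expTerm pp 0 ≡ 0
  expTerm-0 pp with isLoop pp
  ... | true = refl
  ... | false = refl

  markExp-unmarked : ∀ (E Ē : Mults n) → Ē ≡ zeros → markExp (ms E , ms Ē) ≡ 0
  markExp-unmarked E Ē Ē≡0 = trans (markExp-ΣF E Ē) (Σℕ.ΣF-zero (P n) _ (λ q →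
    trans (cong (expTerm (pair q)) (trans (cong (λ z → lookup z q) Ē≡0) (VP.lookup-replicate q 0))) (expTerm-0 (pair q))))

  expTerm-at-loop : ∀ a k → expTerm (pair (idx a a)) k ≡ k
  expTerm-at-loop a k = expTerm-loop (pair (idx a a)) k (trans (isLoop-idx a a) (=ᶠ-refl a))

  expTerm-at-edge : ∀ a b → a ≢ b → ∀ k → expTerm (pair (idx a b)) k ≡ (if k ≡ᵇ 0 then 0 else 1)
  expTerm-at-edge a b ne k = expTerm-edge (pair (idx a b)) k (trans (isLoop-idx a b) (≢⇒=ᶠ ne))

  marked+normal : ∀ (E Ē : Mults n) q {k} → lookup (unionV E Ē) q ≡ k → lookup Ē q + lookup E q ≡ k
  marked+normal E Ē q h = trans (NP.+-comm (lookup Ē q) (lookup E q)) (trans (sym (unionV-lookup E Ē q)) h)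

  module MarkedFamily (𝒟 : ℕ → Bool) (m : ℕ) where

    record InMG* (U : Mults n) : Set where
      field
        mg : MG 𝒟 n m (ms U) ≡ true
        loop≤1 : ∀ v → multAt U v v ≤ 1
        mult≤2 : ∀ v w → multAt U v w ≤ 2
        loop⇒mult≤1 : ∀ v w → multAt U v v ≡ 0 ⊎ multAt U v w ≤ 1
        doubles-disjoint : ∀ u v w → multAt U u v ≡ 2 → multAt U v w ≡ 2 → u ≡ w

    cond-uvw : Mults n → Fin n → Fin n → Fin n → Bool
    cond-uvw U v w u = not ((mult (ms U) u v ≡ᵇ 2) ∧ (mult (ms U) v w ≡ᵇ 2)) ∨ (u =ᶠ w)

    cond-vw : Mults n → Fin n → Fin n → Bool
    cond-vw U v w = (mult (ms U) v w ≤ᵇ 2) ∧ ((mult (ms U) v v ≡ᵇ 0) ∨ (mult (ms U) v w ≤ᵇ 1)) ∧ allV n (cond-uvw U v w)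

    cond-v : Mults n → Fin n → Bool
    cond-v U v = (mult (ms U) v v ≤ᵇ 1) ∧ allV n (cond-vw U v)

    decode-MG* : ∀ (U : Mults n) → MG* 𝒟 n m (ms U) ≡ true → InMG* U
    decode-MG* U e = record { mg = proj₁ (∧-true {MG 𝒟 n m (ms U)} e) ; loop≤1 = loop≤1 ; mult≤2 = mult≤2 ; loop⇒mult≤1 = loop⇒mult≤1 ; doubles-disjoint = doubles-disjoint }
      where
      conditions : allV n (cond-v U) ≡ true
      conditions = proj₂ (∧-true {MG 𝒟 n m (ms U)} e)
      at-v : ∀ v → cond-v U v ≡ true
      at-v v = allV-elim conditions v
      at-vw : ∀ v w → cond-vw U v w ≡ true
      at-vw v w = allV-elim (proj₂ (∧-true {mult (ms U) v v ≤ᵇ 1} (at-v v))) w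
      at-vw′ : ∀ v w → ((mult (ms U) v v ≡ᵇ 0) ∨ (mult (ms U) v w ≤ᵇ 1)) ∧ allV n (cond-uvw U v w) ≡ true
      at-vw′ v w = proj₂ (∧-true {mult (ms U) v w ≤ᵇ 2} (at-vw v w))
      at-uvw : ∀ v w u → cond-uvw U v w u ≡ true
      at-uvw v w u = allV-elim (proj₂ (∧-true {(mult (ms U) v v ≡ᵇ 0) ∨ (mult (ms U) v w ≤ᵇ 1)} (at-vw′ v w))) u
      loop≤1 : ∀ v → multAt U v v ≤ 1
      loop≤1 v = subst (_≤ 1) (mult-lookup U v v) (≤ᵇ⇒≤ (proj₁ (∧-true {mult (ms U) v v ≤ᵇ 1} (at-v v))))
      mult≤2 : ∀ v w → multAt U v w ≤ 2
      mult≤2 v w = subst (_≤ 2) (mult-lookup U v w) (≤ᵇ⇒≤ (proj₁ (∧-true {mult (ms U) v w ≤ᵇ 2} (at-vw v w))))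
      loop⇒mult≤1 : ∀ v w → multAt U v v ≡ 0 ⊎ multAt U v w ≤ 1
      loop⇒mult≤1 v w with ∨-true {mult (ms U) v v ≡ᵇ 0} (proj₁ (∧-true {(mult (ms U) v v ≡ᵇ 0) ∨ (mult (ms U) v w ≤ᵇ 1)} (at-vw′ v w)))
      ... | inj₁ x = inj₁ (trans (sym (mult-lookup U v v)) (≡ᵇ⇒≡ x))
      ... | inj₂ x = inj₂ (subst (_≤ 1) (mult-lookup U v w) (≤ᵇ⇒≤ x))
      doubles-disjoint : ∀ u v w → multAt U u v ≡ 2 → multAt U v w ≡ 2 → u ≡ w
      doubles-disjoint u v w e1 e2 = from-condition (at-uvw v w u)
        where
        double-uv : (mult (ms U) u v ≡ᵇ 2) ≡ true
        double-uv = ≡⇒≡ᵇ _ _ (trans (mult-lookup U u v) e1)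
        double-vw : (mult (ms U) v w ≡ᵇ 2) ≡ true
        double-vw = ≡⇒≡ᵇ _ _ (trans (mult-lookup U v w) e2)
        from-condition : cond-uvw U v w u ≡ true → u ≡ w
        from-condition x rewrite double-uv | double-vw = =ᶠ⇒≡ x

    encode-MG* : ∀ (U : Mults n) → MG 𝒟 n m (ms U) ≡ true → (∀ v → multAt U v v ≡ 0) → (∀ v w → multAt U v w ≤ 1) → MG* 𝒟 n m (ms U) ≡ true
    encode-MG* U mg z le = ∧-intro mg (allV-intro (λ v → ∧-intro (≤⇒≤ᵇ (subst (_≤ 1) (sym (mult-lookup U v v)) (le v v)))
      (allV-intro (λ w → ∧-intro (≤⇒≤ᵇ (subst (_≤ 2) (sym (mult-lookup U v w)) (NP.≤-trans (le v w) (ℕ.s≤s ℕ.z≤n))))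
        (∧-intro (∨-introˡ _ (≡⇒≡ᵇ _ _ (trans (mult-lookup U v v) (z v))))
          (allV-intro (λ u → four u v w)))))))
      where
      four : ∀ u v w → cond-uvw U v w u ≡ true
      four u v w rewrite ≢⇒≡ᵇ (mult (ms U) u v) 2 (λ e → NP.<-irrefl refl (NP.≤-trans (subst (2 ≤_) (trans (sym e) (mult-lookup U u v)) NP.≤-refl) (le u v))) = refl

    record InSG (E : Mults n) : Set where
      field
        mg : MG 𝒟 n m (ms E) ≡ true
        loopless : ∀ v → multAt E v v ≡ 0
        simple : ∀ v w → multAt E v w ≤ 1

    decode-SG : ∀ (E : Mults n) → SG 𝒟 n m (ms E) ≡ true → InSG E
    decode-SG E e = record { mg = mg ; loopless = z ; simple = le }
      where
      mg : MG 𝒟 n m (ms E) ≡ true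
      mg = proj₁ (∧-true {MG 𝒟 n m (ms E)} e)
      conditions : allV n (λ v → (mult (ms E) v v ≡ᵇ 0) ∧ allV n (λ w → mult (ms E) v w ≤ᵇ 1)) ≡ true
      conditions = proj₂ (∧-true {MG 𝒟 n m (ms E)} e)
      at-v : ∀ v → (mult (ms E) v v ≡ᵇ 0) ∧ allV n (λ w → mult (ms E) v w ≤ᵇ 1) ≡ true
      at-v v = allV-elim conditions v
      z : ∀ v → multAt E v v ≡ 0
      z v = trans (sym (mult-lookup E v v)) (≡ᵇ⇒≡ (proj₁ (∧-true {mult (ms E) v v ≡ᵇ 0} (at-v v))))
      le : ∀ v w → multAt E v w ≤ 1
      le v w = subst (_≤ 1) (mult-lookup E v w) (≤ᵇ⇒≤ (allV-elim (proj₂ (∧-true {mult (ms E) v v ≡ᵇ 0} (at-v v))) w))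

    encode-SG : ∀ (E : Mults n) → InSG E → SG 𝒟 n m (ms E) ≡ true
    encode-SG E record { mg = mg ; loopless = z ; simple = le } = ∧-intro mg (allV-intro (λ v → ∧-intro (≡⇒≡ᵇ _ _ (trans (mult-lookup E v v) (z v)))
      (allV-intro (λ w → ≤⇒≤ᵇ (subst (_≤ 1) (sym (mult-lookup E v w)) (le v w))))))

    inMarked : Marked n → Bool
    inMarked G = isInMarked (MG* 𝒟 n m) G

    swap-at-loop : ∀ (E Ē : Mults n) x → InMG* (unionV E Ē) → multAt (unionV E Ē) x x ≡ 1 → VertexCase Ē x →
              VertexCase (Ē [ idx x x ]≔ lookup E (idx x x)) x
    swap-at-loop E Ē x mgs hU mcv with split-1 (lookup Ē (idx x x)) (lookup E (idx x x)) (marked+normal E Ē (idx x x) hU)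
    -- the loop was unmarked, so no marked edge met x; now the marked loop does
    ... | inj₁ (e0 , e1) = inj₂ (inj₁ (trans (upd-self Ē q (lookup E q)) e1 , plus0≡2 _ (subst-update (deg-upd Ē x q (lookup E q)) e0 e1 (occ-loop x) d0)))
      where
      open InMG* mgs
      q : Fin (P n)
      q = idx x x
      unmarked-before : VertexCase Ē x → deg (ms Ē) x ≡ 0
      unmarked-before (inj₁ d) = d
      unmarked-before (inj₂ (inj₁ (l1 , _))) = ⊥-elim (0≢1 (trans (sym e0) l1))
      unmarked-before (inj₂ (inj₂ (w , _ , l2 , _))) with loop⇒mult≤1 x w
      ... | inj₁ z = ⊥-elim (0≢1 (trans (sym z) hU))
      ... | inj₂ le = ⊥-elim (2≤1 (subst (_≤ multAt (unionV E Ē) x w) l2 (marked≤union E Ē (idx x w))) le)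
      d0 : deg (ms Ē) x ≡ 0
      d0 = unmarked-before mcv
    -- the loop was the marked edge at x; now x meets none
    ... | inj₂ (e1 , e0) = inj₁ (plus2≡2 _ (subst-update (deg-upd Ē x q (lookup E q)) e1 e0 (occ-loop x) d2))
      where
      q : Fin (P n)
      q = idx x x
      d2 : deg (ms Ē) x ≡ 2
      d2 = nonzero-deg⇒2 Ē x mcv (pos⇒nz (ℕ.s≤s ℕ.z≤n) (subst-≤₁ (deg-ge1 Ē x q) e1 (occ-loop x)))

    swap-at-edge : ∀ (E Ē : Mults n) x y → x ≢ y → InMG* (unionV E Ē) → multAt (unionV E Ē) x y ≡ 2 → VertexCase Ē x →
              VertexCase (Ē [ idx x y ]≔ lookup E (idx x y)) x
    swap-at-edge E Ē x y ne mgs hU mcv with split-2 (lookup Ē (idx x y)) (lookup E (idx x y)) (marked+normal E Ē (idx x y) hU)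
    -- both copies were unmarked, and by (*) no other marked edge met x
    ... | inj₁ (e0 , e2) = inj₂ (inj₂ (y , ne , trans (upd-self Ē q (lookup E q)) e2 , plus0≡2 _ (subst-update (deg-upd Ē x q (lookup E q)) e0 e2 (occ-nl x y ne) d0)))
      where
      open InMG* mgs
      q : Fin (P n)
      q = idx x y
      unmarked-before : VertexCase Ē x → deg (ms Ē) x ≡ 0
      unmarked-before (inj₁ d) = d
      unmarked-before (inj₂ (inj₁ (l1 , _))) with loop⇒mult≤1 x y
      ... | inj₁ z = ⊥-elim (1≰0 (subst₂ _≤_ l1 z (marked≤union E Ē (idx x x))))
      ... | inj₂ le = ⊥-elim (2≤1 (subst (2 ≤_) (sym hU) NP.≤-refl) le)
      unmarked-before (inj₂ (inj₂ (w , xw , l2 , _))) = ⊥-elim (0≢2 (trans (sym e0) (subst (λ z → multAt Ē x z ≡ 2) w≡y l2)))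
        where
        double-xw : multAt (unionV E Ē) x w ≡ 2
        double-xw = NP.≤-antisym (mult≤2 x w) (subst (_≤ multAt (unionV E Ē) x w) l2 (marked≤union E Ē (idx x w)))
        w≡y : w ≡ y
        w≡y = doubles-disjoint w x y (trans (multAt-sym (unionV E Ē) w x) double-xw) hU
      d0 : deg (ms Ē) x ≡ 0
      d0 = unmarked-before mcv
    ... | inj₂ (inj₁ (e1 , _)) = ⊥-elim (no-single-marked-edge Ē x y ne e1 mcv)
    -- both copies were marked; now x meets no marked edge
    ... | inj₂ (inj₂ (e2 , e0)) = inj₁ (plus2≡2 _ (subst-update (deg-upd Ē x q (lookup E q)) e2 e0 (occ-nl x y ne) d2))
      where
      q : Fin (P n)
      q = idx x y
      d2 : deg (ms Ē) x ≡ 2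
      d2 = nonzero-deg⇒2 Ē x mcv (pos⇒nz (ℕ.s≤s ℕ.z≤n) (subst-≤₁ (deg-ge1 Ē x q) e2 (occ-nl x y ne)))

    vertexOK-swap : ∀ (E Ē : Mults n) a b → InMG* (unionV E Ē) → swappable (unionV E Ē) (idx a b) ≡ true → (∀ v → vertexOK Ē v ≡ true) →
             ∀ x → vertexOK (Ē [ idx a b ]≔ lookup E (idx a b)) x ≡ true
    vertexOK-swap E Ē a b mgs st h x with decode-swappable (unionV E Ē) a b st
    ... | inj₁ (refl , hU) with x Fin.≟ a
    ... | yes refl = encode-vertex _ x (swap-at-loop E Ē x mgs hU (decode-vertex Ē x (h x)))
    ... | no xa = trans (swap-elsewhere Ē a a _ x (λ e → xa (sym e)) (λ e → xa (sym e))) (h x)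
    vertexOK-swap E Ē a b mgs st h x | inj₂ (ne , hU) with x Fin.≟ a | x Fin.≟ b
    ... | yes refl | _ = encode-vertex _ x (swap-at-edge E Ē x b ne mgs hU (decode-vertex Ē x (h x)))
    ... | no xa | yes refl = subst (λ q → vertexOK (Ē [ q ]≔ lookup E q) x ≡ true) (idx-sym x a)
            (encode-vertex _ x (swap-at-edge E Ē x a (λ e → ne (sym e)) mgs (trans (multAt-sym (unionV E Ē) x a) hU) (decode-vertex Ē x (h x))))
    ... | no xa | no xb = trans (swap-elsewhere Ē a b _ x (λ e → xa (sym e)) (λ e → xb (sym e))) (h x)

    inMarked-swap⇒ : ∀ (E Ē : Mults n) a b → swappable (unionV E Ē) (idx a b) ≡ true →
      inMarked (ms E , ms Ē) ≡ true → inMarked (swapMarks (idx a b) (ms E , ms Ē)) ≡ true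
    inMarked-swap⇒ E Ē a b st v =
      ∧-intro (subst (λ z → MG* 𝒟 n m (ms z) ≡ true) (sym (union-swapMarks E Ē (idx a b))) mg)
              (allV-intro (vertexOK-swap E Ē a b (decode-MG* _ mg) st (allV-elim mc)))
      where
      mg : MG* 𝒟 n m (ms (unionV E Ē)) ≡ true
      mg = proj₁ (∧-true {MG* 𝒟 n m (ms (unionV E Ē))} v)
      mc : allV n (vertexOK Ē) ≡ true
      mc = proj₂ (∧-true {MG* 𝒟 n m (ms (unionV E Ē))} v)

    inMarked-swap : ∀ (E Ē : Mults n) a b → swappable (unionV E Ē) (idx a b) ≡ true →
      inMarked (swapMarks (idx a b) (ms E , ms Ē)) ≡ inMarked (ms E , ms Ē)
    inMarked-swap E Ē a b st = bool-ext back (inMarked-swap⇒ E Ē a b st)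
      where
      q : Fin (P n)
      q = idx a b
      twice : swapMarks q (swapMarks q (ms E , ms Ē)) ≡ (ms E , ms Ē)
      twice = cong₂ (λ x y → ms x , ms y) (swapMarks-involutive Ē E q) (swapMarks-involutive E Ē q)
      back : inMarked (swapMarks q (ms E , ms Ē)) ≡ true → inMarked (ms E , ms Ē) ≡ true
      back v = subst (λ G → inMarked G ≡ true) twice
        (inMarked-swap⇒ (E [ q ]≔ lookup Ē q) (Ē [ q ]≔ lookup E q) a b
          (subst (λ z → swappable z q ≡ true) (sym (union-swapMarks E Ē q)) st) v)

    expTerm-swappable : ∀ (E Ē : Mults n) a b → inMarked (ms E , ms Ē) ≡ true → swappable (unionV E Ē) (idx a b) ≡ true →
      (expTerm (pair (idx a b)) (lookup Ē (idx a b)) ≡ 0 × expTerm (pair (idx a b)) (lookup E (idx a b)) ≡ 1) ⊎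
      (expTerm (pair (idx a b)) (lookup Ē (idx a b)) ≡ 1 × expTerm (pair (idx a b)) (lookup E (idx a b)) ≡ 0)
    expTerm-swappable E Ē a b v st with decode-swappable (unionV E Ē) a b st
    ... | inj₁ (refl , hU) with split-1 (lookup Ē (idx a a)) (lookup E (idx a a)) (marked+normal E Ē (idx a a) hU)
    ...   | inj₁ (e0 , e1) = inj₁ (trans (expTerm-at-loop a _) e0 , trans (expTerm-at-loop a _) e1)
    ...   | inj₂ (e1 , e0) = inj₂ (trans (expTerm-at-loop a _) e1 , trans (expTerm-at-loop a _) e0)
    expTerm-swappable E Ē a b v st | inj₂ (ne , hU) with split-2 (lookup Ē (idx a b)) (lookup E (idx a b)) (marked+normal E Ē (idx a b) hU)
    ...   | inj₁ (e0 , e2) = inj₁ (trans (expTerm-at-edge a b ne _) (cong present e0) , trans (expTerm-at-edge a b ne _) (cong present e2))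
      where
      present : ℕ → ℕ
      present k = if k ≡ᵇ 0 then 0 else 1
    ...   | inj₂ (inj₁ (e1 , _)) = ⊥-elim (no-single-marked-edge Ē a b ne e1 (decode-vertex Ē a (allV-elim mc a)))
      where
      mc : allV n (vertexOK Ē) ≡ true
      mc = proj₂ (∧-true {MG* 𝒟 n m (ms (unionV E Ē))} v)
    ...   | inj₂ (inj₂ (e2 , e0)) = inj₂ (trans (expTerm-at-edge a b ne _) (cong present e2) , trans (expTerm-at-edge a b ne _) (cong present e0))
      where
      present : ℕ → ℕ
      present k = if k ≡ᵇ 0 then 0 else 1

    sign-swap : ∀ (E Ē : Mults n) a b → inMarked (ms E , ms Ē) ≡ true → swappable (unionV E Ē) (idx a b) ≡ true →
      sign (markExp (swapMarks (idx a b) (ms E , ms Ē))) ≡ ℤ.- sign (markExp (ms E , ms Ē))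
    sign-swap E Ē a b v st =
      sign-flip _ _ (offset-by-one {a = markExp (swapMarks (idx a b) (ms E , ms Ē))} {b = markExp (ms E , ms Ē)}
                                    (markExp-swap E Ē (idx a b)) (expTerm-swappable E Ē a b v st))

    isZero : Mults n → Bool
    isZero Ē = does (decV Ē zeros)

    simpleUnmarked : Marked n → Bool
    simpleUnmarked G = SG 𝒟 n m (proj₁ G) ∧ isZero (mults (proj₂ G))

    weight : Marked n → ℤ
    weight G = if inMarked G then sign (markExp G) else ℤ.+ 0

    unswappable⇒simple : ∀ (U : Mults n) → InMG* U → (∀ q → swappable U q ≡ false) → (∀ v → multAt U v v ≡ 0) × (∀ v w → multAt U v w ≤ 1)
    unswappable⇒simple U mgs ns = z , le
      where
      open InMG* mgs
      z : ∀ v → multAt U v v ≡ 0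
      z v = ≤1≢1 (loop≤1 v) (≡ᵇ-false⇒≢ (trans (sym (swappable-loop U (idx v v) (trans (isLoop-idx v v) (=ᶠ-refl v)))) (ns (idx v v))))
      le : ∀ v w → multAt U v w ≤ 1
      le v w with v Fin.≟ w
      ... | yes refl = subst (_≤ 1) (sym (z v)) ℕ.z≤n
      ... | no ne = ≤2≢2 (mult≤2 v w) (≡ᵇ-false⇒≢ (trans (sym (swappable-edge U (idx v w) (trans (isLoop-idx v w) (≢⇒=ᶠ ne)))) (ns (idx v w))))

    simple-union⇒unmarked : ∀ (E Ē : Mults n) → allV n (vertexOK Ē) ≡ true →
      (∀ v → multAt (unionV E Ē) v v ≡ 0) → (∀ v w → multAt (unionV E Ē) v w ≤ 1) → Ē ≡ zeros
    simple-union⇒unmarked E Ē mc loopless simple =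
      vec-ext _ _ (λ q → trans (cong (lookup Ē) (idx-pr q)) (trans (unmarked _ _) (sym (VP.lookup-replicate q 0))))
      where
      unmarked : ∀ (a b : Fin n) → lookup Ē (idx a b) ≡ 0
      unmarked a b with lookup Ē (idx a b) in eq
      ... | zero = refl
      ... | suc k = ⊥-elim (impossible (decode-vertex Ē a (allV-elim mc a)))
        where
        deg≥1 : 1 ≤ deg (ms Ē) a
        deg≥1 = NP.≤-trans (NP.≤-trans (occ-pos a b) (NP.m≤m+n _ (k * occ a (pair (idx a b)))))
                (subst (_≤ deg (ms Ē) a) (cong (_* occ a (pair (idx a b))) eq) (deg-ge1 Ē a (idx a b)))
        impossible : VertexCase Ē a → ⊥
        impossible (inj₁ d) = 1≰0 (subst (1 ≤_) d deg≥1)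
        impossible (inj₂ (inj₁ (l1 , _))) = 1≰0 (subst₂ _≤_ l1 (loopless a) (marked≤union E Ē (idx a a)))
        impossible (inj₂ (inj₂ (w , _ , l2 , _))) = 2≤1 (subst (_≤ multAt (unionV E Ē) a w) l2 (marked≤union E Ē (idx a w))) (simple a w)

    fixed⇒simple : ∀ (E Ē : Mults n) → inMarked (ms E , ms Ē) ≡ true → (∀ q → swappable (unionV E Ē) q ≡ false) → Ē ≡ zeros × SG 𝒟 n m (ms E) ≡ true
    fixed⇒simple E Ē v ns = Ē≡0 , encode-SG E (record { mg = subst (λ z → MG 𝒟 n m (ms z) ≡ true) U≡E (InMG*.mg mgs)
                                                ; loopless = λ x → trans (cong (λ z → multAt z x x) (sym U≡E)) (proj₁ U-simple x)
                                                ; simple = λ x y → subst (_≤ 1) (cong (λ z → multAt z x y) U≡E) (proj₂ U-simple x y) })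
      where
      mgs : InMG* (unionV E Ē)
      mgs = decode-MG* _ (proj₁ (∧-true {MG* 𝒟 n m (ms (unionV E Ē))} v))
      U-simple : (∀ v → multAt (unionV E Ē) v v ≡ 0) × (∀ v w → multAt (unionV E Ē) v w ≤ 1)
      U-simple = unswappable⇒simple (unionV E Ē) mgs ns
      Ē≡0 : Ē ≡ zeros
      Ē≡0 = simple-union⇒unmarked E Ē (proj₂ (∧-true {MG* 𝒟 n m (ms (unionV E Ē))} v)) (proj₁ U-simple) (proj₂ U-simple)
      U≡E : unionV E Ē ≡ E
      U≡E = trans (cong (unionV E) Ē≡0) (union-zeros E)

    simple⇒inMarked : ∀ (E Ē : Mults n) → Ē ≡ zeros → SG 𝒟 n m (ms E) ≡ true → inMarked (ms E , ms Ē) ≡ true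
    simple⇒inMarked E .zeros refl sg = ∧-intro (subst (λ z → MG* 𝒟 n m (ms z) ≡ true) (sym (union-zeros E)) (encode-MG* E mg loopless simple))
                                    (allV-intro (λ v → encode-vertex zeros v (inj₁ (deg-zeros v))))
      where open InSG (decode-SG E sg)

    simple⇒unswappable : ∀ (E Ē : Mults n) → simpleUnmarked (ms E , ms Ē) ≡ true → ∀ q → swappable (unionV E Ē) q ≡ false
    simple⇒unswappable E Ē g q = subst (λ r → swappable (unionV E Ē) r ≡ false) (sym (idx-pr q)) (at (proj₁ (pair q)) (proj₂ (pair q)))
      where
      sg : SG 𝒟 n m (ms E) ≡ true
      sg = proj₁ (∧-true {SG 𝒟 n m (ms E)} g)
      Ē≡0 : Ē ≡ zeros
      Ē≡0 = does-true (decV Ē zeros) (proj₂ (∧-true {SG 𝒟 n m (ms E)} g))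
      U≡E : unionV E Ē ≡ E
      U≡E = trans (cong (unionV E) Ē≡0) (union-zeros E)
      open InSG (decode-SG E sg)
      at : ∀ (a b : Fin n) → swappable (unionV E Ē) (idx a b) ≡ false
      at a b with a Fin.≟ b
      ... | yes refl = trans (swappable-loop (unionV E Ē) (idx a a) (trans (isLoop-idx a a) (=ᶠ-refl a)))
                         (≢⇒≡ᵇ _ 1 (λ e → 0≢1 (trans (sym (loopless a)) (trans (cong (λ w → multAt w a a) (sym U≡E)) e))))
      ... | no ne = trans (swappable-edge (unionV E Ē) (idx a b) (trans (isLoop-idx a b) (≢⇒=ᶠ ne)))
                         (≢⇒≡ᵇ _ 2 (λ e → 2≤1 (subst (2 ≤_) (trans (sym e) (cong (λ w → multAt w a b) U≡E)) NP.≤-refl) (simple a b)))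

-- Orderings of an unmarked simple graph.  A sequence orders (E , ∅) iff its first
-- triple is an unmarked copy (v , w) of an edge of E and the rest orders E minus
-- that edge.  Each edge {v , w} of a simple graph can be written as (v , w) and as
-- (w , v), so summing over the first triple gives 2m times the orderings of a
-- graph with m - 1 edges, and hence 2^m m! orderings by induction.

module OrderingCounts {n : ℕ} where
  private
    pair : Fin (P n) → Fin n × Fin n
    pair = pr {n}

  -- the number of sequences of length m ordering G (= orderings G when G has m edges)
  orderCount : ∀ m → Marked n → ℕ
  orderCount m G = length (filter (λ s → markedOf s ≟ᴹ G) (seqs (triples n) m))

  orderCount-ΣL : ∀ m G → orderCount m G ≡ ΣL (seqs (triples n) m) (λ s → ⟦ does (markedOf s ≟ᴹ G) ⟧)
  orderCount-ΣL m G = length-filter (λ s → markedOf s ≟ᴹ G) (seqs (triples n) m)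

  IsSimple : Mults n → Set
  IsSimple E = (∀ q → lookup E q ≤ 1) × (∀ q → isLoop (pair q) ≡ true → lookup E q ≡ 0)

  normalOf markedMultsOf : ∀ {m} → Vec (Triple n) m → Mults n
  normalOf s = mults (edgesWith false s)
  markedMultsOf s = mults (edgesWith true s)

  cons-lookup : ∀ {m} t (x : Triple n) (s : Vec (Triple n) m) r →
    lookup (mults (edgesWith t (x ∷ s))) r ≡ hits t (pair r) x + lookup (mults (edgesWith t s)) r
  cons-lookup {m} t x s r = trans (edgesWith-lookup t (x ∷ s) r) (cong (hits t (pair r) x +_) (sym (edgesWith-lookup t s r)))

  hits-at : ∀ t v w b → hits t (pair (idx v w)) (v , w , b) ≡ (if ⌊ b Bool.≟ t ⌋ then 1 else 0)
  hits-at t v w b rewrite idx-rep v w = refl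

  hits-off : ∀ t v w b r → r ≢ idx v w → hits t (pair r) (v , w , b) ≡ 0
  hits-off t v w b r ne with represents (pair r) v w in eq
  ... | true = ⊥-elim (ne (idx-uniq v w r eq))
  ... | false = refl

  hits-unmarked : ∀ r (v w : Fin n) → hits true (pair r) (v , w , false) ≡ 0
  hits-unmarked r v w rewrite BP.∧-zeroʳ (represents (pair r) v w) = refl

  zeros-lookup : ∀ r → lookup (zeros {P n}) r ≡ 0
  zeros-lookup r = VP.lookup-replicate r 0

  normal-at : ∀ {G H : Marked n} → G ≡ H → ∀ r → lookup (mults (proj₁ G)) r ≡ lookup (mults (proj₁ H)) r
  normal-at e r = cong (λ G → lookup (mults (proj₁ G)) r) e

  marked-at : ∀ {G H : Marked n} → G ≡ H → ∀ r → lookup (mults (proj₂ G)) r ≡ lookup (mults (proj₂ H)) r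
  marked-at e r = cong (λ G → lookup (mults (proj₂ G)) r) e

  marked-ext : ∀ (G : Marked n) (X Y : Mults n) → (∀ r → lookup (mults (proj₁ G)) r ≡ lookup X r) → (∀ r → lookup (mults (proj₂ G)) r ≡ lookup Y r) → G ≡ (ms X , ms Y)
  marked-ext G X Y p q = cong₂ _,_ (cong ms (vec-ext _ X p)) (cong ms (vec-ext _ Y q))

  marked-first-≢ : ∀ {m} (E : Mults n) v w (s : Vec (Triple n) m) → markedOf ((v , w , true) ∷ s) ≢ (ms E , ms zeros)
  marked-first-≢ E v w s e =
    NP.1+n≢0 (trans (sym (trans (cons-lookup true (v , w , true) s (idx v w))
                                (cong (_+ lookup (markedMultsOf s) (idx v w)) (hits-at true v w true))))
                    (trans (marked-at e (idx v w)) (zeros-lookup (idx v w))))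

  absent-first-≢ : ∀ {m} (E : Mults n) v w (s : Vec (Triple n) m) → lookup E (idx v w) ≡ 0 →
    markedOf ((v , w , false) ∷ s) ≢ (ms E , ms zeros)
  absent-first-≢ E v w s eq e =
    NP.1+n≢0 (trans (sym (trans (cons-lookup false (v , w , false) s (idx v w))
                                (cong (_+ lookup (normalOf s) (idx v w)) (hits-at false v w false))))
                    (trans (normal-at e (idx v w)) eq))

  first-removed : ∀ {m} (E : Mults n) v w k (s : Vec (Triple n) m) → lookup E (idx v w) ≡ suc k →
    markedOf ((v , w , false) ∷ s) ≡ (ms E , ms zeros) → markedOf s ≡ (ms (E [ idx v w ]≔ k) , ms zeros)
  first-removed E v w k s eq e = marked-ext (markedOf s) (E [ q ]≔ k) zeros normal marked
    where
    q : Fin (P n)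
    q = idx v w
    x : Triple n
    x = (v , w , false)
    normal : ∀ r → lookup (normalOf s) r ≡ lookup (E [ q ]≔ k) r
    normal r with r Fin.≟ q
    ... | yes refl = trans (NP.suc-injective (trans (sym (trans (cons-lookup false x s r) (cong (_+ lookup (normalOf s) r) (hits-at false v w false)))) (trans (normal-at e r) eq)))
                           (sym (VP.lookup∘update r E k))
    ... | no ne = trans (trans (sym (trans (cons-lookup false x s r) (cong (_+ lookup (normalOf s) r) (hits-off false v w false r ne)))) (normal-at e r))
                        (sym (VP.lookup∘update′ ne E k))
    marked : ∀ r → lookup (markedMultsOf s) r ≡ lookup zeros r
    marked r = trans (sym (trans (cons-lookup true x s r) (cong (_+ lookup (markedMultsOf s) r) (hits-unmarked r v w)))) (marked-at e r)

  first-added : ∀ {m} (E : Mults n) v w k (s : Vec (Triple n) m) → lookup E (idx v w) ≡ suc k →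
    markedOf s ≡ (ms (E [ idx v w ]≔ k) , ms zeros) → markedOf ((v , w , false) ∷ s) ≡ (ms E , ms zeros)
  first-added E v w k s eq e = marked-ext (markedOf (x ∷ s)) E zeros normal marked
    where
    q : Fin (P n)
    q = idx v w
    x : Triple n
    x = (v , w , false)
    normal : ∀ r → lookup (normalOf (x ∷ s)) r ≡ lookup E r
    normal r with r Fin.≟ q
    ... | yes refl = trans (cons-lookup false x s r) (trans (cong₂ _+_ (hits-at false v w false) (normal-at e r))
                       (trans (cong suc (VP.lookup∘update r E k)) (sym eq)))
    ... | no ne = trans (cons-lookup false x s r) (trans (cong₂ _+_ (hits-off false v w false r ne) (normal-at e r))
                       (VP.lookup∘update′ ne E k))
    marked : ∀ r → lookup (markedMultsOf (x ∷ s)) r ≡ lookup zeros r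
    marked r = trans (cons-lookup true x s r) (cong₂ _+_ (hits-unmarked r v w) (marked-at e r))

  orderCount-step : ∀ {m} (E : Mults n) v w b (s : Vec (Triple n) m) →
    ⟦ does (markedOf ((v , w , b) ∷ s) ≟ᴹ (ms E , ms zeros)) ⟧ ≡
    (if b then 0 else (if 1 ≤ᵇ lookup E (idx v w) then ⟦ does (markedOf s ≟ᴹ (ms (E [ idx v w ]≔ ℕ.pred (lookup E (idx v w))) , ms zeros)) ⟧ else 0))
  orderCount-step E v w true s = cong ⟦_⟧ (dec-false (markedOf ((v , w , true) ∷ s) ≟ᴹ (ms E , ms zeros)) (marked-first-≢ E v w s))
  orderCount-step E v w false s with lookup E (idx v w) in eq
  ... | zero = cong ⟦_⟧ (dec-false (markedOf ((v , w , false) ∷ s) ≟ᴹ (ms E , ms zeros)) (absent-first-≢ E v w s eq))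
  ... | suc k = cong ⟦_⟧ (does-⇔ (mk⇔ (first-removed E v w k s eq) (first-added E v w k s eq))
                                 (markedOf ((v , w , false) ∷ s) ≟ᴹ (ms E , ms zeros)) (markedOf s ≟ᴹ (ms (E [ idx v w ]≔ k) , ms zeros)))

  Σδ : ∀ (b : Fin n) → ΣF n (λ w → ⟦ b =ᶠ w ⟧) ≡ 1
  Σδ b = trans (Σℕ.ΣF-single n _ b (λ w ne → cong ⟦_⟧ (≢⇒=ᶠ (λ e → ne (sym e))))) (cong ⟦_⟧ (=ᶠ-refl b))

  Σδ2 : ∀ (a b : Fin n) → ΣF n (λ v → ΣF n (λ w → ⟦ (a =ᶠ v) ∧ (b =ᶠ w) ⟧)) ≡ 1
  Σδ2 a b = trans (Σℕ.ΣF-single n _ a (λ v ne → Σℕ.ΣF-zero n _ (λ w → cong (λ z → ⟦ z ∧ (b =ᶠ w) ⟧) (≢⇒=ᶠ (λ e → ne (sym e))))))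
                  (trans (Σℕ.ΣF-cong n (λ w → cong (λ z → ⟦ z ∧ (b =ᶠ w) ⟧) (=ᶠ-refl a))) (Σδ b))

  edge-represented-twice : ∀ (i j : Fin n) → i ≢ j → ΣF n (λ v → ΣF n (λ w → ⟦ represents (i , j) v w ⟧)) ≡ 2
  edge-represented-twice i j ne = begin
      ΣF n (λ v → ΣF n (λ w → ⟦ represents (i , j) v w ⟧))
    ≡⟨ Σℕ.ΣF-cong n (λ v → Σℕ.ΣF-cong n (λ w → ⟦∨⟧ (i =ᶠ v ∧ j =ᶠ w) (i =ᶠ w ∧ j =ᶠ v) (not-both v w))) ⟩
      ΣF n (λ v → ΣF n (λ w → ⟦ i =ᶠ v ∧ j =ᶠ w ⟧ + ⟦ i =ᶠ w ∧ j =ᶠ v ⟧))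
    ≡⟨ Σℕ.ΣF-cong n (λ v → Σℕ.ΣF-⊕ n _ _) ⟩
      ΣF n (λ v → ΣF n (λ w → ⟦ i =ᶠ v ∧ j =ᶠ w ⟧) + ΣF n (λ w → ⟦ i =ᶠ w ∧ j =ᶠ v ⟧))
    ≡⟨ Σℕ.ΣF-⊕ n _ _ ⟩
      ΣF n (λ v → ΣF n (λ w → ⟦ i =ᶠ v ∧ j =ᶠ w ⟧)) + ΣF n (λ v → ΣF n (λ w → ⟦ i =ᶠ w ∧ j =ᶠ v ⟧))
    ≡⟨ cong₂ _+_ (Σδ2 i j) (trans (Σℕ.ΣF-cong n (λ v → Σℕ.ΣF-cong n (λ w → cong ⟦_⟧ (BP.∧-comm (i =ᶠ w) (j =ᶠ v))))) (Σδ2 j i)) ⟩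
      2
    ∎
    where
    open ≡-Reasoning
    not-both : ∀ v w → (i =ᶠ v ∧ j =ᶠ w) ∧ (i =ᶠ w ∧ j =ᶠ v) ≡ true → ⊥
    not-both v w e with i =ᶠ v in e1 | j =ᶠ w in e2 | i =ᶠ w in e3
    ... | true | true | true = ne (trans (=ᶠ⇒≡ e3) (sym (=ᶠ⇒≡ e2)))
    ... | true | true | false = t≢f (sym e)
    ... | true | false | _ = t≢f (sym e)
    ... | false | _ | _ = t≢f (sym e)

  entry-as-ΣF : ∀ (E : Mults n) v w → lookup E (idx v w) ≡ ΣF (P n) (λ q → lookup E q * ⟦ represents (pair q) v w ⟧)
  entry-as-ΣF E v w = trans (sym (mult-lookup E v w)) (trans (sum-zipWith-ΣF _ (pairs n) E) (Σℕ.ΣF-cong (P n) entry-term))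
    where
    entry-term : ∀ q → (if represents (pair q) v w then lookup E q else 0) ≡ lookup E q * ⟦ represents (pair q) v w ⟧
    entry-term q with represents (pair q) v w
    ... | true = sym (NP.*-identityʳ (lookup E q))
    ... | false = sym (NP.*-zeroʳ (lookup E q))

  handshake : ∀ (E : Mults n) → IsSimple E → ΣF n (λ v → ΣF n (λ w → lookup E (idx v w))) ≡ Vec.sum E * 2
  handshake E (le , lp) = begin
      ΣF n (λ v → ΣF n (λ w → lookup E (idx v w)))
    ≡⟨ Σℕ.ΣF-cong n (λ v → Σℕ.ΣF-cong n (λ w → entry-as-ΣF E v w)) ⟩
      ΣF n (λ v → ΣF n (λ w → ΣF (P n) (λ q → lookup E q * ⟦ represents (pair q) v w ⟧)))
    ≡⟨ Σℕ.ΣF-cong n (λ v → Σℕ.ΣF-swap n (P n) _) ⟩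
      ΣF n (λ v → ΣF (P n) (λ q → ΣF n (λ w → lookup E q * ⟦ represents (pair q) v w ⟧)))
    ≡⟨ Σℕ.ΣF-swap n (P n) _ ⟩
      ΣF (P n) (λ q → ΣF n (λ v → ΣF n (λ w → lookup E q * ⟦ represents (pair q) v w ⟧)))
    ≡⟨ Σℕ.ΣF-cong (P n) (λ q → trans (Σℕ.ΣF-cong n (λ v → Σℕ.ΣF-scal n (lookup E q) _)) (Σℕ.ΣF-scal n (lookup E q) _)) ⟩
      ΣF (P n) (λ q → lookup E q * ΣF n (λ v → ΣF n (λ w → ⟦ represents (pair q) v w ⟧)))
    ≡⟨ Σℕ.ΣF-cong (P n) entry-term ⟩
      ΣF (P n) (λ q → 2 * lookup E q)
    ≡⟨ Σℕ.ΣF-scal (P n) 2 (lookup E) ⟩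
      2 * ΣF (P n) (lookup E)
    ≡⟨ cong (2 *_) (sym (sum-ΣF E)) ⟩
      2 * Vec.sum E
    ≡⟨ NP.*-comm 2 (Vec.sum E) ⟩
      Vec.sum E * 2
    ∎
    where
    open ≡-Reasoning
    entry-term : ∀ q → lookup E q * ΣF n (λ v → ΣF n (λ w → ⟦ represents (pair q) v w ⟧)) ≡ 2 * lookup E q
    entry-term q with isLoop (pair q) in il
    ... | true = trans (cong (_* _) (lp q il)) (sym (cong (2 *_) (lp q il)))
    ... | false = trans (cong (lookup E q *_) (edge-represented-twice (proj₁ (pair q)) (proj₂ (pair q)) (=ᶠ-false⇒≢ il))) (NP.*-comm (lookup E q) 2)

  sum-upd : ∀ (E : Mults n) q a → Vec.sum (E [ q ]≔ a) + lookup E q ≡ Vec.sum E + a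
  sum-upd E q a = trans (cong (_+ lookup E q) (sum-ΣF (E [ q ]≔ a)))
    (trans (ΣF-update (P n) (lookup (E [ q ]≔ a)) (lookup E) q (λ r ne → VP.lookup∘update′ ne E a))
      (cong₂ _+_ (sym (sum-ΣF E)) (VP.lookup∘update q E a)))

  IsSimple-decrement : ∀ (E : Mults n) q → IsSimple E → IsSimple (E [ q ]≔ ℕ.pred (lookup E q))
  IsSimple-decrement E q (le , lp) = le' , lp'
    where
    le' : ∀ r → lookup (E [ q ]≔ ℕ.pred (lookup E q)) r ≤ 1
    le' r with r Fin.≟ q
    ... | yes refl = subst (_≤ 1) (sym (VP.lookup∘update r E _)) (NP.≤-trans (NP.pred[n]≤n) (le r))
    ... | no ne = subst (_≤ 1) (sym (VP.lookup∘update′ ne E _)) (le r)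
    lp' : ∀ r → isLoop (pair r) ≡ true → lookup (E [ q ]≔ ℕ.pred (lookup E q)) r ≡ 0
    lp' r il with r Fin.≟ q
    ... | yes refl = trans (VP.lookup∘update r E _) (cong ℕ.pred (lp r il))
    ... | no ne = trans (VP.lookup∘update′ ne E _) (lp r il)

  markedOf-[] : markedOf {n} {0} [] ≡ (ms zeros , ms zeros)
  markedOf-[] = marked-ext (markedOf {n} {0} []) zeros zeros (λ r → trans (edgesWith-lookup {n} false [] r) (sym (zeros-lookup r))) (λ r → trans (edgesWith-lookup {n} true [] r) (sym (zeros-lookup r)))

  ΣL-by-first : ∀ m (F : Vec (Triple n) (suc m) → ℕ) →
    ΣL (seqs (triples n) (suc m)) F ≡
    ΣF n (λ v → ΣF n (λ w → ΣL (seqs (triples n) m) (λ s → F ((v , w , true) ∷ s))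
                            + (ΣL (seqs (triples n) m) (λ s → F ((v , w , false) ∷ s)) + 0)))
  ΣL-by-first m F = begin
      ΣL (seqs (triples n) (suc m)) F
    ≡⟨ Σℕ.ΣL-concatMap (λ x → map (x ∷_) (seqs (triples n) m)) (triples n) F ⟩
      ΣL (triples n) (λ x → ΣL (map (x ∷_) (seqs (triples n) m)) F)
    ≡⟨ Σℕ.ΣL-cong (triples n) (λ x → Σℕ.ΣL-map (x ∷_) (seqs (triples n) m) F) ⟩
      ΣL (triples n) Φ
    ≡⟨ Σℕ.ΣL-cart (allFin n) (cartesianProduct (allFin n) (true ∷ false ∷ [])) Φ ⟩
      ΣL (allFin n) (λ v → ΣL (cartesianProduct (allFin n) (true ∷ false ∷ [])) (λ y → Φ (v , y)))
    ≡⟨ Σℕ.ΣL-cong (allFin n) (λ v → Σℕ.ΣL-cart (allFin n) (true ∷ false ∷ []) (λ y → Φ (v , y))) ⟩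
      ΣL (allFin n) (λ v → ΣL (allFin n) (λ w → Φ (v , w , true) + (Φ (v , w , false) + 0)))
    ≡⟨ trans (Σℕ.ΣL-allFin n _) (Σℕ.ΣF-cong n (λ v → Σℕ.ΣL-allFin n _)) ⟩
      ΣF n (λ v → ΣF n (λ w → Φ (v , w , true) + (Φ (v , w , false) + 0)))
    ∎
    where
    open ≡-Reasoning
    Φ : Triple n → ℕ
    Φ x = ΣL (seqs (triples n) m) (λ s → F (x ∷ s))

  count-identity : ∀ m a b → (suc m * 2) * (a * b) ≡ (2 * a) * (b + m * b)
  count-identity = solve-∀
    where open import Data.Nat.Tactic.RingSolver

  marked-first-count : ∀ m (E : Mults n) v w →
    ΣL (seqs (triples n) m) (λ s → ⟦ does (markedOf ((v , w , true) ∷ s) ≟ᴹ (ms E , ms zeros)) ⟧) ≡ 0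
  marked-first-count m E v w = Σℕ.ΣL-zero (seqs (triples n) m) _ (λ s → orderCount-step E v w true s)

  -- after an unmarked first triple on {v , w}, the rest orders E minus {v , w}, which
  -- is possible iff |E|_{v,w} = 1; given the count N for graphs with m edges, this
  -- yields |E|_{v,w} · N sequences
  unmarked-first-count : ∀ m (E : Mults n) → IsSimple E → Vec.sum E ≡ suc m →
    (∀ (E′ : Mults n) → IsSimple E′ → Vec.sum E′ ≡ m → orderCount m (ms E′ , ms zeros) ≡ 2 ^ m * m !) →
    ∀ v w → ΣL (seqs (triples n) m) (λ s → ⟦ does (markedOf ((v , w , false) ∷ s) ≟ᴹ (ms E , ms zeros)) ⟧) ≡ lookup E (idx v w) * (2 ^ m * m !)
  unmarked-first-count m E sp sz count v w =
    trans (Σℕ.ΣL-cong (seqs (triples n) m) (λ s → orderCount-step E v w false s)) (by-entry (lookup E q) refl)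
    where
    q : Fin (P n)
    q = idx v w
    by-entry : ∀ c → lookup E q ≡ c →
      ΣL (seqs (triples n) m) (λ s → if 1 ≤ᵇ lookup E q then ⟦ does (markedOf s ≟ᴹ (ms (E [ q ]≔ ℕ.pred (lookup E q)) , ms zeros)) ⟧ else 0)
        ≡ lookup E q * (2 ^ m * m !)
    by-entry zero eq rewrite eq = Σℕ.ΣL-zero (seqs (triples n) m) _ (λ s → refl)
    by-entry (suc zero) eq rewrite eq =
      trans (sym (orderCount-ΣL m _))
            (trans (count (E [ q ]≔ 0) (subst (λ z → IsSimple (E [ q ]≔ ℕ.pred z)) eq (IsSimple-decrement E q sp)) remaining)
                   (sym (NP.+-identityʳ _)))
      where
      remaining : Vec.sum (E [ q ]≔ 0) ≡ m
      remaining = NP.+-cancelʳ-≡ 1 _ _ (trans (subst (λ z → Vec.sum (E [ q ]≔ 0) + z ≡ Vec.sum E + 0) eq (sum-upd E q 0))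
                    (trans (NP.+-identityʳ _) (trans sz (NP.+-comm 1 m))))
    by-entry (suc (suc c)) eq = ⊥-elim (NP.<-irrefl refl (NP.≤-trans (subst (2 ≤_) (sym eq) (ℕ.s≤s (ℕ.s≤s ℕ.z≤n))) (proj₁ sp q)))

  orderCount-simple : ∀ m (E : Mults n) → IsSimple E → Vec.sum E ≡ m → orderCount m (ms E , ms zeros) ≡ 2 ^ m * m !
  orderCount-simple zero E sp sz = trans (orderCount-ΣL 0 (ms E , ms zeros))
    (cong (_+ 0) (cong ⟦_⟧ (dec-true (markedOf {n} {0} [] ≟ᴹ (ms E , ms zeros)) (trans markedOf-[] (cong (λ z → ms z , ms zeros) (sym E≡zeros))))))
    where
    E≡zeros : E ≡ zeros
    E≡zeros = vec-ext E zeros (λ r → trans (ΣF-zeros (P n) (lookup E) (trans (sym (sum-ΣF E)) sz) r) (sym (zeros-lookup r)))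
  orderCount-simple (suc m) E sp sz = begin
      orderCount (suc m) (ms E , ms zeros)
    ≡⟨ orderCount-ΣL (suc m) (ms E , ms zeros) ⟩
      ΣL (seqs (triples n) (suc m)) (λ s → ⟦ does (markedOf s ≟ᴹ (ms E , ms zeros)) ⟧)
    ≡⟨ ΣL-by-first m _ ⟩
      ΣF n (λ v → ΣF n (λ w → Φ (v , w , true) + (Φ (v , w , false) + 0)))
    ≡⟨ Σℕ.ΣF-cong n (λ v → Σℕ.ΣF-cong n (λ w →
         cong₂ _+_ (marked-first-count m E v w) (trans (NP.+-identityʳ _) (unmarked-first-count m E sp sz (orderCount-simple m) v w)))) ⟩
      ΣF n (λ v → ΣF n (λ w → lookup E (idx v w) * N))
    ≡⟨ Σℕ.ΣF-cong n (λ v → trans (Σℕ.ΣF-cong n (λ w → NP.*-comm (lookup E (idx v w)) N)) (Σℕ.ΣF-scal n N _)) ⟩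
      ΣF n (λ v → N * ΣF n (λ w → lookup E (idx v w)))
    ≡⟨ Σℕ.ΣF-scal n N _ ⟩
      N * ΣF n (λ v → ΣF n (λ w → lookup E (idx v w)))
    ≡⟨ cong (N *_) (handshake E sp) ⟩
      N * (Vec.sum E * 2)
    ≡⟨ trans (NP.*-comm N _) (cong (λ z → (z * 2) * N) sz) ⟩
      (suc m * 2) * (2 ^ m * m !)
    ≡⟨ count-identity m (2 ^ m) (m !) ⟩
      2 ^ suc m * suc m !
    ∎
    where
    open ≡-Reasoning
    N : ℕ
    N = 2 ^ m * m !
    Φ : Triple n → ℕ
    Φ x = ΣL (seqs (triples n) m) (λ s → ⟦ does (markedOf (x ∷ s) ≟ᴹ (ms E , ms zeros)) ⟧)

-- Choosing the swap: the first swappable pair.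

firstTrue : ∀ {k} → (Fin k → Bool) → Maybe (Fin k)
firstTrue {zero} f = nothing
firstTrue {suc k} f with f Fin.zero
... | true = just Fin.zero
... | false = Data.Maybe.map Fin.suc (firstTrue (f ∘ Fin.suc))

firstTrue-just : ∀ {k} (f : Fin k → Bool) p → firstTrue f ≡ just p → f p ≡ true
firstTrue-just {suc k} f p e with f Fin.zero in eq
firstTrue-just {suc k} f .Fin.zero refl | true = eq
... | false with firstTrue (f ∘ Fin.suc) in e2
firstTrue-just {suc k} f .(Fin.suc q) refl | false | just q = firstTrue-just (f ∘ Fin.suc) q e2

firstTrue-nothing : ∀ {k} (f : Fin k → Bool) → firstTrue f ≡ nothing → ∀ q → f q ≡ false
firstTrue-nothing {suc k} f e q with f Fin.zero in eq
firstTrue-nothing {suc k} f () q | true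
... | false with firstTrue (f ∘ Fin.suc) in e2
firstTrue-nothing {suc k} f refl Fin.zero | false | nothing = eq
firstTrue-nothing {suc k} f refl (Fin.suc q) | false | nothing = firstTrue-nothing (f ∘ Fin.suc) e2 q

isNothing : ∀ {k} → Maybe (Fin k) → Bool
isNothing nothing = true
isNothing (just _) = false

isJustAt : ∀ {k} → Maybe (Fin k) → Fin k → Bool
isJustAt nothing p = false
isJustAt (just q) p = does (q Fin.≟ p)

split-by-first : ∀ {k} (mb : Maybe (Fin k)) (h : ℤ) →
  h ≡ (if isNothing mb then h else ℤ.+ 0) ℤ.+ Σℤ.ΣF k (λ p → if isJustAt mb p then h else ℤ.+ 0)
split-by-first {k} nothing h = sym (trans (cong (ℤ._+_ h) (Σℤ.ΣF-ε k)) (ZP.+-identityʳ h))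
split-by-first {k} (just q) h =
  sym (trans (ZP.+-identityˡ _) (trans (Σℤ.ΣF-single k _ q off) (cong (λ b → if b then h else ℤ.+ 0) (dec-true (q Fin.≟ q) refl))))
  where
  off : ∀ p → p ≢ q → (if does (q Fin.≟ p) then h else ℤ.+ 0) ≡ ℤ.+ 0
  off p ne = cong (λ b → if b then h else ℤ.+ 0) (dec-false (q Fin.≟ p) (λ e → ne (sym e)))

self-negation⇒0 : ∀ (x : ℤ) → x ≡ ℤ.- x → x ≡ ℤ.+ 0
self-negation⇒0 (ℤ.+ zero) e = refl
self-negation⇒0 (ℤ.+ suc n) ()
self-negation⇒0 ℤ.-[1+ n ] ()

[_]ℤ : Bool → ℤ
[ b ]ℤ = if b then ℤ.+ 1 else ℤ.+ 0

[b]ℤ : ∀ b → [ b ]ℤ ≡ ℤ.+ ⟦ b ⟧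
[b]ℤ true = refl
[b]ℤ false = refl

module SignedSum (𝒟 : ℕ → Bool) (n m : ℕ) where
  open MultiplicityFacts {n}
  open MultiplicityFacts.MarkedFamily {n} 𝒟 m
  open OrderingCounts {n}

  unionOf : Marked n → Mults n
  unionOf G = unionV (mults (proj₁ G)) (mults (proj₂ G))

  firstSwappable : Marked n → Maybe (Fin (P n))
  firstSwappable G = firstTrue (swappable (unionOf G))

  -- swapping does not change the union, hence not the first swappable pair
  firstSwappable-swap : ∀ p G → firstSwappable (swapMarks p G) ≡ firstSwappable G
  firstSwappable-swap p G = cong (λ U → firstTrue (swappable U)) (union-swapMarks (mults (proj₁ G)) (mults (proj₂ G)) p)

  weight-swap-at : ∀ (E Ē : Mults n) a b → swappable (unionV E Ē) (idx a b) ≡ true → weight (swapMarks (idx a b) (ms E , ms Ē)) ≡ ℤ.- weight (ms E , ms Ē)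
  weight-swap-at E Ē a b st with inMarked (ms E , ms Ē) in ev
  ... | true = trans (cong (λ z → if z then sign (markExp (swapMarks (idx a b) (ms E , ms Ē))) else ℤ.+ 0) (trans (inMarked-swap E Ē a b st) ev))
                     (sign-swap E Ē a b ev st)
  ... | false = cong (λ z → if z then sign (markExp (swapMarks (idx a b) (ms E , ms Ē))) else ℤ.+ 0) (trans (inMarked-swap E Ē a b st) ev)

  weight-swap : ∀ (G : Marked n) p → swappable (unionOf G) p ≡ true → weight (swapMarks p G) ≡ ℤ.- weight G
  weight-swap G p st = subst (λ q → swappable (unionOf G) q ≡ true → weight (swapMarks q G) ≡ ℤ.- weight G) (sym (idx-pr p))
                       (weight-swap-at (mults (proj₁ G)) (mults (proj₂ G)) (proj₁ (pair p)) (proj₂ (pair p))) st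

  inMarked-unswappable : ∀ (G : Marked n) → (∀ q → swappable (unionOf G) q ≡ false) → inMarked G ≡ simpleUnmarked G
  inMarked-unswappable G ns =
    bool-ext (λ v → let (Ē≡0 , sg) = fixed⇒simple E Ē v ns in ∧-intro sg (dec-true (decV Ē zeros) Ē≡0))
             (λ g → simple⇒inMarked E Ē (does-true (decV Ē zeros) (proj₂ (∧-true {SG 𝒟 n m (ms E)} g))) (proj₁ (∧-true {SG 𝒟 n m (ms E)} g)))
    where
    E Ē : Mults n
    E = mults (proj₁ G)
    Ē = mults (proj₂ G)

  weight-unswappable : ∀ (G : Marked n) → (∀ q → swappable (unionOf G) q ≡ false) → weight G ≡ [ simpleUnmarked G ]ℤ
  weight-unswappable G ns = trans (cong (λ b → if b then sign (markExp G) else ℤ.+ 0) (inMarked-unswappable G ns))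
                                  (by-cases (simpleUnmarked G) refl)
    where
    by-cases : ∀ b → simpleUnmarked G ≡ b → (if b then sign (markExp G) else ℤ.+ 0) ≡ [ b ]ℤ
    by-cases true eg = cong sign (markExp-unmarked (mults (proj₁ G)) (mults (proj₂ G))
                         (does-true (decV (mults (proj₂ G)) zeros) (proj₂ (∧-true {SG 𝒟 n m (proj₁ G)} eg))))
    by-cases false _ = refl

  fixedPart : Marked n → ℤ
  fixedPart G = if isNothing (firstSwappable G) then weight G else ℤ.+ 0

  partAt : Marked n → Fin (P n) → ℤ
  partAt G p = if isJustAt (firstSwappable G) p then weight G else ℤ.+ 0

  fixedPart≡ : ∀ G → fixedPart G ≡ [ simpleUnmarked G ]ℤ
  fixedPart≡ G with firstSwappable G in eπ
  ... | nothing = weight-unswappable G (firstTrue-nothing (swappable (unionOf G)) eπ)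
  ... | just q with simpleUnmarked G in eg
  ... | false = refl
  ... | true = ⊥-elim (t≢f (trans (sym (firstTrue-just (swappable (unionOf G)) q eπ))
                   (simple⇒unswappable (mults (proj₁ G)) (mults (proj₂ G)) eg q)))

  -- swapping at p negates the part at p (the first swappable pair stays p)
  partAt-swap : ∀ G p → partAt (swapMarks p G) p ≡ ℤ.- partAt G p
  partAt-swap G p rewrite firstSwappable-swap p G with firstSwappable G in eπ
  ... | nothing = refl
  ... | just q with q Fin.≟ p
  ... | yes refl = weight-swap G q (firstTrue-just (swappable (unionOf G)) q eπ)
  ... | no _ = refl

  sequences : List (Vec (Triple n) m)
  sequences = seqs (triples n) m

  -- the part at p is negated by toggling p, a bijection of the sequences, so it sums to 0
  partAt-cancels : ∀ p → Σℤ.ΣL sequences (λ s → partAt (markedOf s) p) ≡ ℤ.+ 0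
  partAt-cancels p = self-negation⇒0 _ (trans (sym (seqs-toggle-invariant p m F)) (trans (Σℤ.ΣL-cong sequences negated) (ΣL-neg sequences F)))
    where
    F : Vec (Triple n) m → ℤ
    F s = partAt (markedOf s) p
    negated : ∀ s → F (Vec.map (toggle p) s) ≡ ℤ.- F s
    negated s = trans (cong (λ G → partAt G p) (markedOf-toggle p s)) (partAt-swap (markedOf s) p)

  involution-sum : Σℤ.ΣL sequences (λ s → weight (markedOf s)) ≡ Σℤ.ΣL sequences (λ s → [ simpleUnmarked (markedOf s) ]ℤ)
  involution-sum = begin
      Σℤ.ΣL sequences (λ s → weight (markedOf s))
    ≡⟨ Σℤ.ΣL-cong sequences (λ s → split-by-first (firstSwappable (markedOf s)) (weight (markedOf s))) ⟩
      Σℤ.ΣL sequences (λ s → fixedPart (markedOf s) ℤ.+ Σℤ.ΣF (P n) (partAt (markedOf s)))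
    ≡⟨ Σℤ.ΣL-⊕ sequences _ _ ⟩
      Σℤ.ΣL sequences (λ s → fixedPart (markedOf s)) ℤ.+ Σℤ.ΣL sequences (λ s → Σℤ.ΣF (P n) (partAt (markedOf s)))
    ≡⟨ cong₂ ℤ._+_ (Σℤ.ΣL-cong sequences (λ s → fixedPart≡ (markedOf s))) parts-cancel ⟩
      Σℤ.ΣL sequences (λ s → [ simpleUnmarked (markedOf s) ]ℤ) ℤ.+ ℤ.+ 0
    ≡⟨ ZP.+-identityʳ _ ⟩
      Σℤ.ΣL sequences (λ s → [ simpleUnmarked (markedOf s) ]ℤ)
    ∎
    where
    open ≡-Reasoning
    parts-cancel : Σℤ.ΣL sequences (λ s → Σℤ.ΣF (P n) (partAt (markedOf s))) ≡ ℤ.+ 0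
    parts-cancel = trans (Σℤ.ΣL-cong sequences (λ s → sym (Σℤ.ΣL-allFin (P n) (partAt (markedOf s)))))
      (trans (Σℤ.ΣL-swap sequences (allFin (P n)) (λ s p → partAt (markedOf s) p)) (Σℤ.ΣL-zero (allFin (P n)) _ partAt-cancels))

  inMarked-size : ∀ (G : Marked n) → inMarked G ≡ true → edgeCount G ≡ m
  inMarked-size G v = trans (sym (sum-union (mults (proj₁ G)) (mults (proj₂ G))))
    (≡ᵇ⇒≡ (proj₁ (∧-true {size (ms {n} (unionOf G)) ≡ᵇ m} (proj₁ (∧-true {MG 𝒟 n m (ms {n} (unionOf G))} (proj₁ (∧-true {MG* 𝒟 n m (ms {n} (unionOf G))} v)))))))

  orderings-as-sequence-sum : Σℤ.ΣL (markedAll n m) (λ G → weight G ℤ.* ℤ.+ orderings G) ≡ Σℤ.ΣL sequences (λ s → weight (markedOf s))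
  orderings-as-sequence-sum = trans (Σℤ.ΣL-cong (markedAll n m) with-length) (fibre-sum _≟ᴹ_ (markedAll n m) sequences markedOf weight once)
    where
    with-length : ∀ G → weight G ℤ.* ℤ.+ orderings G ≡ weight G ℤ.* ℤ.+ orderCount m G
    with-length G with inMarked G in ev
    ... | true = cong (λ k → sign (markExp G) ℤ.* ℤ.+ orderCount k G) (inMarked-size G ev)
    ... | false = trans (ZP.*-zeroˡ (ℤ.+ orderings G)) (sym (ZP.*-zeroˡ (ℤ.+ orderCount m G)))
    once : ∀ s → weight (markedOf s) ≡ ℤ.+ 0 ⊎ occurrences _≟ᴹ_ (markedOf s) (markedAll n m) ≡ 1
    once s with inMarked (markedOf s) in ev
    ... | false = inj₁ refl
    ... | true = inj₂ (markedAll-once {n} m (mults (proj₁ (markedOf s))) (mults (proj₂ (markedOf s))) (inMarked-size (markedOf s) ev))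

  SG-size : ∀ (A : Mults n) → SG 𝒟 n m (ms A) ≡ true → Vec.sum A ≡ m
  SG-size A sg = ≡ᵇ⇒≡ (proj₁ (∧-true {size (ms {n} A) ≡ᵇ m} (InSG.mg (decode-SG A sg))))

  SG-simple : ∀ (A : Mults n) → SG 𝒟 n m (ms A) ≡ true → IsSimple A
  SG-simple A sg = at-most-one , no-loop
    where
    open InSG (decode-SG A sg)
    at-most-one : ∀ q → lookup A q ≤ 1
    at-most-one q = subst (_≤ 1) (cong (lookup A) (sym (idx-pr q))) (simple (proj₁ (pair q)) (proj₂ (pair q)))
    no-loop : ∀ q → isLoop (pair q) ≡ true → lookup A q ≡ 0
    no-loop q il = trans (cong (lookup A) (idx-pr q)) (subst (λ w → lookup A (idx a w) ≡ 0) a≡b (loopless a))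
      where
      a b : Fin n
      a = proj₁ (pair q)
      b = proj₂ (pair q)
      a≡b : a ≡ b
      a≡b = =ᶠ⇒≡ (trans (sym (isLoop-idx a b)) (trans (cong (λ r → isLoop (pair r)) (sym (idx-pr q))) il))

  sequence-sum-as-unmarked : Σℤ.ΣL sequences (λ s → [ simpleUnmarked (markedOf s) ]ℤ) ≡ Σℤ.ΣL (unmarkedAll n m) (λ G → [ simpleUnmarked G ]ℤ ℤ.* ℤ.+ orderCount m G)
  sequence-sum-as-unmarked = sym (fibre-sum _≟ᴹ_ (unmarkedAll n m) sequences markedOf (λ G → [ simpleUnmarked G ]ℤ) once)
    where
    once : ∀ s → [ simpleUnmarked (markedOf s) ]ℤ ≡ ℤ.+ 0 ⊎ occurrences _≟ᴹ_ (markedOf s) (unmarkedAll n m) ≡ 1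
    once s with simpleUnmarked (markedOf s) in eg
    ... | false = inj₁ refl
    ... | true = inj₂ (subst (λ z → occurrences _≟ᴹ_ (ms E , ms z) (unmarkedAll n m) ≡ 1) (sym Ē≡0) (unmarkedAll-once {n} m E (SG-size E sg)))
      where
      E Ē : Mults n
      E = mults (proj₁ (markedOf s))
      Ē = mults (proj₂ (markedOf s))
      sg : SG 𝒟 n m (ms E) ≡ true
      sg = proj₁ (∧-true {SG 𝒟 n m (ms E)} eg)
      Ē≡0 : Ē ≡ zeros
      Ē≡0 = does-true (decV Ē zeros) (proj₂ (∧-true {SG 𝒟 n m (ms E)} eg))

  orderingsPerSimple : ℕ
  orderingsPerSimple = 2 ^ m * m !

  unmarked-sum-as-card : Σℤ.ΣL (unmarkedAll n m) (λ G → [ simpleUnmarked G ]ℤ ℤ.* ℤ.+ orderCount m G) ≡ ℤ.+ card n m (SG 𝒟 n m) ℤ.* ℤ.+ orderingsPerSimple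
  unmarked-sum-as-card = begin
      Σℤ.ΣL (unmarkedAll n m) (λ G → [ simpleUnmarked G ]ℤ ℤ.* ℤ.+ orderCount m G)
    ≡⟨ Σℤ.ΣL-map (λ A → A , ms zeros) (multisets n m) _ ⟩
      Σℤ.ΣL (multisets n m) (λ A → [ simpleUnmarked (A , ms zeros) ]ℤ ℤ.* ℤ.+ orderCount m (A , ms zeros))
    ≡⟨ Σℤ.ΣL-cong (multisets n m) contribution ⟩
      Σℤ.ΣL (multisets n m) (λ A → ℤ.+ orderingsPerSimple ℤ.* [ SG 𝒟 n m A ]ℤ)
    ≡⟨ Σℤ.ΣL-scal (multisets n m) (ℤ.+ orderingsPerSimple) _ ⟩
      ℤ.+ orderingsPerSimple ℤ.* Σℤ.ΣL (multisets n m) (λ A → [ SG 𝒟 n m A ]ℤ)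
    ≡⟨ cong (ℤ._*_ (ℤ.+ orderingsPerSimple)) (trans (Σℤ.ΣL-cong (multisets n m) (λ A → [b]ℤ (SG 𝒟 n m A))) (sym (+-ΣL (multisets n m) _))) ⟩
      ℤ.+ orderingsPerSimple ℤ.* ℤ.+ ΣL (multisets n m) (λ A → ⟦ SG 𝒟 n m A ⟧)
    ≡⟨ cong (λ z → ℤ.+ orderingsPerSimple ℤ.* ℤ.+ z) (sym (length-filter (λ E → T? (SG 𝒟 n m E)) (multisets n m))) ⟩
      ℤ.+ orderingsPerSimple ℤ.* ℤ.+ card n m (SG 𝒟 n m)
    ≡⟨ ZP.*-comm (ℤ.+ orderingsPerSimple) _ ⟩
      ℤ.+ card n m (SG 𝒟 n m) ℤ.* ℤ.+ orderingsPerSimple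
    ∎
    where
    open ≡-Reasoning
    contribution : ∀ (A : EdgeMS n) → [ simpleUnmarked (A , ms zeros) ]ℤ ℤ.* ℤ.+ orderCount m (A , ms zeros) ≡ ℤ.+ orderingsPerSimple ℤ.* [ SG 𝒟 n m A ]ℤ
    contribution A with SG 𝒟 n m A in e
    ... | false = trans (ZP.*-zeroˡ (ℤ.+ orderCount m (A , ms zeros))) (sym (ZP.*-zeroʳ (ℤ.+ orderingsPerSimple)))
    ... | true = trans (cong (λ b → [ b ]ℤ ℤ.* ℤ.+ orderCount m (A , ms zeros)) (dec-true (decV (zeros {P n}) zeros) refl))
                   (trans (cong (λ k → ℤ.+ 1 ℤ.* ℤ.+ k) (orderCount-simple m (mults A) (SG-simple (mults A) e) (SG-size (mults A) e)))
                     (trans (ZP.*-identityˡ (ℤ.+ orderingsPerSimple)) (sym (ZP.*-identityʳ (ℤ.+ orderingsPerSimple)))))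

  signed-count : Σℤ.ΣL (markedAll n m) (λ G → weight G ℤ.* ℤ.+ orderings G) ≡ ℤ.+ card n m (SG 𝒟 n m) ℤ.* ℤ.+ orderingsPerSimple
  signed-count = begin
      Σℤ.ΣL (markedAll n m) (λ G → weight G ℤ.* ℤ.+ orderings G)
    ≡⟨ orderings-as-sequence-sum ⟩
      Σℤ.ΣL sequences (λ s → weight (markedOf s))
    ≡⟨ involution-sum ⟩
      Σℤ.ΣL sequences (λ s → [ simpleUnmarked (markedOf s) ]ℤ)
    ≡⟨ sequence-sum-as-unmarked ⟩
      Σℤ.ΣL (unmarkedAll n m) (λ G → [ simpleUnmarked G ]ℤ ℤ.* ℤ.+ orderCount m G)
    ≡⟨ unmarked-sum-as-card ⟩
      ℤ.+ card n m (SG 𝒟 n m) ℤ.* ℤ.+ orderingsPerSimple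
    ∎
    where open ≡-Reasoning

-- Passing to ℚ.  Computations are done with unnormalised fractions (ℚᵘ).

toℚᵘ-/ : ∀ (i : ℤ) (d : ℕ) .{{_ : ℕ.NonZero d}} → ℚ.toℚᵘ (i ℚ./ d) ≃ mkℚᵘ i (ℕ.pred d)
toℚᵘ-/ i (suc d) = QP.toℚᵘ-fromℚᵘ (mkℚᵘ i d)

fr-cong : ∀ {a b} k → a ≡ b → mkℚᵘ a k ≃ mkℚᵘ b k
fr-cong k refl = QUP.≃-refl

fr-+ : ∀ a b k → (mkℚᵘ a k ℚᵘ.+ mkℚᵘ b k) ≃ mkℚᵘ (a ℤ.+ b) k
fr-+ a b k = *≡* (trans (common-denominator a b D) (cong ((a ℤ.+ b) ℤ.*_) (sym (ZP.pos-* (suc k) (suc k)))))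
  where
  D : ℤ
  D = ℤ.+ suc k
  common-denominator : ∀ a b D → (a ℤ.* D ℤ.+ b ℤ.* D) ℤ.* D ≡ (a ℤ.+ b) ℤ.* (D ℤ.* D)
  common-denominator = solve-∀
    where open import Data.Integer.Tactic.RingSolver

fr-*1 : ∀ a b k → (mkℚᵘ a k ℚᵘ.* mkℚᵘ b 0) ≃ mkℚᵘ (a ℤ.* b) k
fr-*1 a b k = *≡* (cong ((a ℤ.* b) ℤ.*_) (cong ℤ.+_ (sym (NP.*-identityʳ (suc k)))))

sign-+ : ∀ x y → sign (x + y) ≡ sign x ℤ.* sign y
sign-+ zero y = sym (ZP.*-identityˡ (sign y))
sign-+ (suc x) y = trans (cong ℤ.-_ (sign-+ x y)) (ZP.neg-distribˡ-* (sign x) (sign y))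

power-of-minus-one : ∀ k → ℚ.toℚᵘ ((ℚ.- ℚ.1ℚ) ^ℚ k) ≃ mkℚᵘ (sign k) 0
power-of-minus-one zero = QUP.≃-refl
power-of-minus-one (suc k) = QUP.≃-trans (QP.toℚᵘ-homo-* (ℚ.- ℚ.1ℚ) ((ℚ.- ℚ.1ℚ) ^ℚ k))
  (QUP.≃-trans (QUP.*-cong {ℚ.toℚᵘ (ℚ.- ℚ.1ℚ)} QUP.≃-refl (power-of-minus-one k)) (fr-cong 0 (ZP.-1*i≡-i (sign k))))

filter-true : ∀ {A : Set} (p : A → Bool) x L → p x ≡ true → filter (λ G → T? (p G)) (x ∷ L) ≡ x ∷ filter (λ G → T? (p G)) L
filter-true p x L e rewrite e = refl

filter-false : ∀ {A : Set} (p : A → Bool) x L → p x ≡ false → filter (λ G → T? (p G)) (x ∷ L) ≡ filter (λ G → T? (p G)) L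
filter-false p x L e rewrite e = refl

module Evaluation (𝒟 : ℕ → Bool) (n m : ℕ) where
  open MultiplicityFacts.MarkedFamily {n} 𝒟 m using (inMarked; weight)
  open SignedSum 𝒟 n m using (inMarked-size; orderingsPerSimple)

  denom : ℕ
  denom = ℕ.pred orderingsPerSimple

  suc-denom : suc denom ≡ orderingsPerSimple
  suc-denom = NP.suc-pred orderingsPerSimple {{m*n≢0 (2 ^ m) (m !) {{m^n≢0 2 m}} {{m !≢0}}}}

  term : Marked n → ℚ
  term G = κ G ℚ.* ((ℚ.- ℚ.1ℚ) ^ℚ kk G) ℚ.* ((ℚ.- ℚ.1ℚ) ^ℚ ℓ G)

  κ≃ : ∀ (G : Marked n) → edgeCount G ≡ m → ℚ.toℚᵘ (κ G) ≃ mkℚᵘ (ℤ.+ orderings G) denom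
  κ≃ G e = QUP.≃-trans (toℚᵘ-/ (ℤ.+ orderings G) (2 ^ edgeCount G * edgeCount G !) {{m*n≢0 (2 ^ edgeCount G) (edgeCount G !) {{m^n≢0 2 (edgeCount G)}} {{edgeCount G !≢0}}}})
             (QUP.≃-reflexive (cong (λ z → mkℚᵘ (ℤ.+ orderings G) (ℕ.pred (2 ^ z * z !))) e))

  term≃ : ∀ (G : Marked n) → inMarked G ≡ true → ℚ.toℚᵘ (term G) ≃ mkℚᵘ (weight G ℤ.* ℤ.+ orderings G) denom
  term≃ G v = begin
      ℚ.toℚᵘ (κ G ℚ.* s₁ ℚ.* s₂)
    ≈⟨ QP.toℚᵘ-homo-* (κ G ℚ.* s₁) s₂ ⟩
      ℚ.toℚᵘ (κ G ℚ.* s₁) ℚᵘ.* ℚ.toℚᵘ s₂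
    ≈⟨ QUP.*-cong (QP.toℚᵘ-homo-* (κ G) s₁) (QUP.≃-refl {ℚ.toℚᵘ s₂}) ⟩
      (ℚ.toℚᵘ (κ G) ℚᵘ.* ℚ.toℚᵘ s₁) ℚᵘ.* ℚ.toℚᵘ s₂
    ≈⟨ QUP.*-cong (QUP.*-cong (κ≃ G (inMarked-size G v)) (power-of-minus-one (kk G))) (power-of-minus-one (ℓ G)) ⟩
      (mkℚᵘ (ℤ.+ orderings G) denom ℚᵘ.* mkℚᵘ (sign (kk G)) 0) ℚᵘ.* mkℚᵘ (sign (ℓ G)) 0
    ≈⟨ QUP.*-cong (fr-*1 (ℤ.+ orderings G) (sign (kk G)) denom) (QUP.≃-refl {mkℚᵘ (sign (ℓ G)) 0}) ⟩
      mkℚᵘ (ℤ.+ orderings G ℤ.* sign (kk G)) denom ℚᵘ.* mkℚᵘ (sign (ℓ G)) 0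
    ≈⟨ fr-*1 (ℤ.+ orderings G ℤ.* sign (kk G)) (sign (ℓ G)) denom ⟩
      mkℚᵘ ((ℤ.+ orderings G ℤ.* sign (kk G)) ℤ.* sign (ℓ G)) denom
    ≈⟨ fr-cong denom (trans (regroup (ℤ.+ orderings G) (sign (kk G)) (sign (ℓ G)))
                            (cong (ℤ._* ℤ.+ orderings G) (trans (sym (sign-+ (kk G) (ℓ G))) (sym weight≡)))) ⟩
      mkℚᵘ (weight G ℤ.* ℤ.+ orderings G) denom
    ∎
    where
    open QUP.≃-Reasoning
    s₁ s₂ : ℚ
    s₁ = (ℚ.- ℚ.1ℚ) ^ℚ kk G
    s₂ = (ℚ.- ℚ.1ℚ) ^ℚ ℓ G
    weight≡ : weight G ≡ sign (kk G + ℓ G)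
    weight≡ rewrite v = refl
    regroup : ∀ o a b → (o ℤ.* a) ℤ.* b ≡ (a ℤ.* b) ℤ.* o
    regroup = solve-∀
      where open import Data.Integer.Tactic.RingSolver

  signedSum : List (Marked n) → ℤ
  signedSum L = Σℤ.ΣL L (λ G → weight G ℤ.* ℤ.+ orderings G)

  gfSum : List (Marked n) → ℚ
  gfSum L = foldr ℚ._+_ ℚ.0ℚ (map term (filter (λ G → T? (inMarked G)) L))

  gfSum≃ : ∀ (L : List (Marked n)) → ℚ.toℚᵘ (gfSum L) ≃ mkℚᵘ (signedSum L) denom
  gfSum≃ [] = *≡* refl
  gfSum≃ (x ∷ L) = by-membership (inMarked x) refl
    where
    by-membership : ∀ b → inMarked x ≡ b → ℚ.toℚᵘ (gfSum (x ∷ L)) ≃ mkℚᵘ (signedSum (x ∷ L)) denom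
    by-membership true ev = subst (λ r → ℚ.toℚᵘ r ≃ mkℚᵘ (signedSum (x ∷ L)) denom)
      (sym (cong (λ l → foldr ℚ._+_ ℚ.0ℚ (map term l)) (filter-true inMarked x L ev)))
      (QUP.≃-trans (QP.toℚᵘ-homo-+ (term x) (gfSum L))
        (QUP.≃-trans (QUP.+-cong (term≃ x ev) (gfSum≃ L)) (fr-+ (weight x ℤ.* ℤ.+ orderings x) (signedSum L) denom)))
    by-membership false ev = subst (λ r → ℚ.toℚᵘ r ≃ mkℚᵘ (signedSum (x ∷ L)) denom)
      (sym (cong (λ l → foldr ℚ._+_ ℚ.0ℚ (map term l)) (filter-false inMarked x L ev)))
      (QUP.≃-trans (gfSum≃ L) (fr-cong denom (sym (trans (cong (ℤ._+ signedSum L) no-weight) (ZP.+-identityˡ (signedSum L))))))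
      where
      no-weight : weight x ℤ.* ℤ.+ orderings x ≡ ℤ.+ 0
      no-weight = trans (cong (λ b → (if b then sign (kk x + ℓ x) else ℤ.+ 0) ℤ.* ℤ.+ orderings x) ev) (ZP.*-zeroˡ (ℤ.+ orderings x))

  cancel-denominator : ∀ c → mkℚᵘ (c ℤ.* ℤ.+ orderingsPerSimple) denom ≃ mkℚᵘ c 0
  cancel-denominator c = *≡* (trans (ZP.*-identityʳ (c ℤ.* ℤ.+ orderingsPerSimple)) (cong (c ℤ.*_) (cong ℤ.+_ (sym suc-denom))))

-- the integer embedding (kept qualified above, where it would clash with ℕ sections)
open import Data.Integer using (+_)

lemma2 : (𝒟 : ℕ → Bool) (n m : ℕ) →
    MarkedGF n m (MG* 𝒟 n m) (- 1ℚ) (- 1ℚ) ≡ (+ card n m (SG 𝒟 n m)) / 1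
lemma2 𝒟 n m = QP.toℚᵘ-injective (begin
    ℚ.toℚᵘ (MarkedGF n m (MG* 𝒟 n m) (- 1ℚ) (- 1ℚ))
  ≈⟨ gfSum≃ (markedAll n m) ⟩
    mkℚᵘ (signedSum (markedAll n m)) denom
  ≈⟨ fr-cong denom signed-count ⟩
    mkℚᵘ (+ card n m (SG 𝒟 n m) ℤ.* + orderingsPerSimple) denom
  ≈⟨ cancel-denominator (+ card n m (SG 𝒟 n m)) ⟩
    mkℚᵘ (+ card n m (SG 𝒟 n m)) 0
  ≈⟨ QUP.≃-sym (toℚᵘ-/ (+ card n m (SG 𝒟 n m)) 1) ⟩
    ℚ.toℚᵘ ((+ card n m (SG 𝒟 n m)) / 1)
  ∎)
  where
  open Evaluation 𝒟 n m
  open SignedSum 𝒟 n m using (signed-count; orderingsPerSimple)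
  open QUP.≃-Reasoning
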